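{- Let $R$ be a unique factorization domain with quotient field $Q(R)$, and let $f$ and $g$ be Dirichlet polynomials with coefficients in $R$ of coprime degrees $m$ and $n$ respectively, with $m<n$. Let $p_1,\dots,p_r$ be the distinct prime factors of $m\cdot n$, let $p$ be a prime element of $R$ dividing neither the leading coefficient of $f$ nor that of $g$, and let $k$ be any positive integer with $\gcd(k,\ \nu_{p_1}(n)-\nu_{p_1}(m),\dots,\nu_{p_r}(n)-\nu_{p_r}(m))=1$. Then $f(s)+p^kg(s)$ is irreducible over $Q(R)$.
   Context: A Dirichlet polynomial is a finite sum $\sum_i\frac{a_i}{i^s}$; its degree is the largest $i$ with $a_i\ne0$ and its leading coefficient is that $a_i$. Products are Dirichlet products $\left(\sum_j\frac{b_j}{j^s}\right)\left(\sum_k\frac{c_k}{k^s}\right)=\sum_i\frac{\sum_{jk=i}b_jc_k}{i^s}$; constant means supported on $\{1\}$. Irreducible over $Q(R)$: not a product of two nonconstant Dirichlet polynomials with coefficients in $Q(R)$. $\nu_q$ denotes the $q$-adic valuation. -}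

module Defs where

open import Level using (Level; _⊔_)
open import Data.Nat as ℕ using (ℕ; zero; suc; _≡ᵇ_)
open import Data.Nat.Divisibility using (_∣?_; divides)
open import Data.Bool using (if_then_else_)
open import Data.Product using (Σ; ∃; _×_; _,_)
open import Data.Sum using (_⊎_)
open import Data.List using (List; []; _∷_)
open import Data.List.Relation.Unary.All using (All)
open import Data.List.Relation.Binary.Permutation.Homogeneous using (Permutation)
open import Relation.Nullary using (¬_; yes; no)
open import Algebra.Bundles using (CommutativeRing)
open import Algebra.Morphism.Structures using (IsRingHomomorphism)

-- q-adic valuation of a natural number (for q ≥ 2 and n ≥ 1):
-- ν q n = largest e with q^e ∣ n.  Computed by repeated division,
-- with fuel n (enough since q ≥ 2).

valAux : ℕ → ℕ → ℕ → ℕ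
valAux zero    q n = 0
valAux (suc f) q n with q ∣? n
... | yes (divides k _) = suc (valAux f q k)
... | no _              = 0

ν : ℕ → ℕ → ℕ
ν q n = valAux n q n

module _ {c ℓ : Level} (R : CommutativeRing c ℓ) where
  open CommutativeRing R

  Divides : Carrier → Carrier → Set (c ⊔ ℓ)
  Divides a b = ∃ λ x → b ≈ a * x

  IsUnit : Carrier → Set (c ⊔ ℓ)
  IsUnit a = ∃ λ x → a * x ≈ 1#

  Associated : Carrier → Carrier → Set (c ⊔ ℓ)
  Associated a b = ∃ λ u → IsUnit u × b ≈ a * u

  IsIntegralDomain : Set (c ⊔ ℓ)
  IsIntegralDomain = (¬ (1# ≈ 0#)) × (∀ a b → a * b ≈ 0# → a ≈ 0# ⊎ b ≈ 0#)

  IsIrreducibleElt : Carrier → Set (c ⊔ ℓ)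
  IsIrreducibleElt a = (¬ (a ≈ 0#)) × (¬ IsUnit a) ×
                       (∀ x y → a ≈ x * y → IsUnit x ⊎ IsUnit y)

  IsPrimeElt : Carrier → Set (c ⊔ ℓ)
  IsPrimeElt p = (¬ (p ≈ 0#)) × (¬ IsUnit p) ×
                 (∀ a b → Divides p (a * b) → Divides p a ⊎ Divides p b)

  prodL : List Carrier → Carrier
  prodL []       = 1#
  prodL (x ∷ xs) = x * prodL xs

  IsUFD : Set (c ⊔ ℓ)
  IsUFD = IsIntegralDomain
        × (∀ a → ¬ (a ≈ 0#) → ¬ IsUnit a →
             ∃ λ xs → All IsIrreducibleElt xs × a ≈ prodL xs)
        × (∀ xs ys → All IsIrreducibleElt xs → All IsIrreducibleElt ys →
             prodL xs ≈ prodL ys → Permutation Associated xs ys)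

  IsField : Set (c ⊔ ℓ)
  IsField = (¬ (1# ≈ 0#)) × (∀ a → ¬ (a ≈ 0#) → IsUnit a)

  pow : Carrier → ℕ → Carrier
  pow a zero    = 1#
  pow a (suc k) = a * pow a k

  -- Dirichlet polynomials  Σ_{i ≥ 1} a_i / i^s  with coefficients in R.
  -- coeff i is a_i for i ≥ 1; the value at index 0 is ignored everywhere.

  record DirPoly : Set (c ⊔ ℓ) where
    field
      coeff   : ℕ → Carrier
      support : ∃ λ N → ∀ i → N ℕ.< i → coeff i ≈ 0#
  open DirPoly public

  HasDegree : DirPoly → ℕ → Set ℓ
  HasDegree f m = (1 ℕ.≤ m) × (¬ (coeff f m ≈ 0#)) ×
                  (∀ i → m ℕ.< i → coeff f i ≈ 0#)

  IsConstant : DirPoly → Set ℓ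
  IsConstant f = ∀ i → 2 ℕ.≤ i → coeff f i ≈ 0#

  sumTo : (ℕ → Carrier) → ℕ → Carrier
  sumTo h zero    = 0#
  sumTo h (suc n) = sumTo h n + h (suc n)

  dirMulCoeff : DirPoly → DirPoly → ℕ → Carrier
  dirMulCoeff f g i =
    sumTo (λ j → sumTo (λ k → if (j ℕ.* k) ≡ᵇ i then coeff f j * coeff g k else 0#) i) i

module _ {c ℓ : Level} (R : CommutativeRing c ℓ) where
  open CommutativeRing R

  addScaled : DirPoly R → Carrier → DirPoly R → ℕ → Carrier
  addScaled f a g i = coeff f i + a * coeff g i

module _ {c₁ ℓ₁ c₂ ℓ₂ : Level}
         (R : CommutativeRing c₁ ℓ₁) (K : CommutativeRing c₂ ℓ₂) where
  private
    module R = CommutativeRing R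
    module K = CommutativeRing K

  IsQuotientField : (R.Carrier → K.Carrier) → Set (c₁ ⊔ ℓ₁ ⊔ c₂ ⊔ ℓ₂)
  IsQuotientField ι =
      IsField K
    × IsRingHomomorphism R.rawRing K.rawRing ι
    × (∀ a b → ι a K.≈ ι b → a R.≈ b)
    × (∀ x → ∃ λ a → ∃ λ b → (¬ (b R.≈ R.0#)) × (x K.* ι b K.≈ ι a))

  IrreducibleOver : (R.Carrier → K.Carrier) → (ℕ → R.Carrier) → Set (c₂ ⊔ ℓ₂)
  IrreducibleOver ι h =
    ¬ (Σ (DirPoly K) λ u → Σ (DirPoly K) λ v →
         (¬ IsConstant K u) × (¬ IsConstant K v) ×
         (∀ i → 1 ℕ.≤ i → ι (h i) K.≈ dirMulCoeff K u v i))

module Submission where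

-- Suppose f + p^k g factors into two nonconstant Dirichlet polynomials over Q(R). Clearing
-- denominators and applying Gauss's lemma for p, it factors as U V over R. Give a term of index i
-- whose coefficient is exactly divisible by p^e the weight (n/m)^e / i^k, which is multiplicative.
-- Every term of f + p^k g has weight at least 1/m^k, the common weight of its terms (m , 0) and
-- (n , k). The terms of least weight of U and of V (largest index among ties) multiply to a term
-- of U V that no other product cancels, so the product of the least weights is at least 1/m^k.
-- Let a be the last index of a coefficient of U prime to p, d₁ the degree of U and p^k₁ the exact
-- power of p dividing its leading coefficient, and b, d₂, k₂ likewise for V. Then a b = m,
-- d₁ d₂ = n and k₁ + k₂ = k, so (a , 0), (d₁ , k₁) and the least term of U all have the same
-- weight: m^k₁ d₁^k = n^k₁ a^k. Coprimality of m and n gives 0 < k₁ < k, whereas comparing q-adic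
-- valuations in this identity, the condition on k gives k ∣ k₁.

open import Defs
open import Level using (Level; _⊔_)
open import Function using (_∘_)
open import Data.Nat as Nat
  using (ℕ; zero; suc; _≤_; _<_; z≤n; s≤s; NonZero; >-nonZero; _≟_; _≤?_; _<?_; _≡ᵇ_)
open import Data.Nat.Properties as ℕₚ
  using (≤-refl; ≤-trans; <-≤-trans; <⇒≤; <⇒≱; ≤-reflexive; ≰⇒>; ≮⇒≥; ≤∧≢⇒<; m≤n⇒m≤1+n; ≤-pred; <-cmp)
import Data.Nat.Divisibility as ℕ∣
open import Data.Nat.Coprimality using (Coprime; coprime-divisor)
open import Data.Nat.GCD using (gcd; gcd[m,n]∣m; gcd[m,n]∣n; gcd-greatest; gcd[m,n]≢0)
open import Data.Nat.Primality using (Prime; euclidsLemma; prime⇒nonTrivial; prime⇒nonZero)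
open import Data.Nat.Tactic.RingSolver using (solve-∀)
open import Data.Bool using (true; false; if_then_else_; T)
open import Data.Unit using (tt)
open import Data.Product using (_×_; _,_; proj₁; proj₂; ∃; Σ)
open import Data.Sum using (_⊎_; inj₁; inj₂)
open import Data.Empty using (⊥; ⊥-elim)
open import Data.List using ([]; _∷_; _++_; replicate; length)
import Data.List.Properties as Listₚ
open import Data.List.Relation.Unary.All using (All)
open import Data.List.Relation.Unary.All.Properties using (++⁺; replicate⁺)
import Data.List.Relation.Binary.Permutation.Homogeneous as Permutation
import Data.Fin.Permutation as FinPermutation
open import Relation.Binary.PropositionalEquality as ≡ using (_≡_; _≢_)
open import Relation.Binary.Definitions using (tri<; tri≈; tri>)
open import Relation.Nullary using (¬_; Dec; yes; no)
open import Relation.Nullary.Decidable using (¬¬-excluded-middle)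
open import Algebra.Bundles using (CommutativeRing)
open import Algebra.Morphism.Structures using (IsRingHomomorphism)
import Algebra.Properties.CommutativeSemigroup as CommutativeSemigroupProperties
import Algebra.Properties.AbelianGroup as AbelianGroupProperties
import Algebra.Properties.Ring as RingProperties

private variable
  ℓ₀ : Level
  X : Set ℓ₀

-- Classical steps are taken inside proofs of ⊥: in do-notation, x ← m binds the double negation m.
_>>=_ : ¬ ¬ X → (X → ⊥) → ⊥
m >>= k = m k

step-down : {P : ℕ → Set ℓ₀} {N : ℕ} → P (suc N) → (∀ i → suc N < i → P i) → ∀ i → N < i → P i
step-down {N = N} pN beyond i N<i with i ≟ suc N
... | yes ≡.refl = pN
... | no  i≢  = beyond i (≤∧≢⇒< N<i (λ e → i≢ (≡.sym e)))

LastFailure : (ℕ → Set ℓ₀) → ℕ → Set ℓ₀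
LastFailure Z d = 1 ≤ d × ¬ Z d × (∀ i → d < i → Z i)

lastFailure : (Z : ℕ → Set ℓ₀) (N : ℕ) → (∀ i → N < i → Z i) → ¬ (∀ i → 1 ≤ i → Z i) →
              ¬ ¬ ∃ (LastFailure Z)
lastFailure Z zero    beyond notAll _ = notAll (λ i 1≤i → beyond i 1≤i)
lastFailure Z (suc N) beyond notAll k = do
  yes z ← ¬¬-excluded-middle
    where no ¬z → k (suc N , s≤s z≤n , ¬z , beyond)
  lastFailure Z N (step-down z beyond) notAll k

lastFailure-≤ : ∀ {Z : ℕ → Set ℓ₀} {d i} → LastFailure Z d → ¬ Z i → i ≤ d
lastFailure-≤ {d = d} {i} (_ , _ , above) ¬zi with i ≤? d
... | yes i≤d = i≤d
... | no  i≰d = ⊥-elim (¬zi (above i (≰⇒> i≰d)))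

lastFailure-unique : ∀ {Z Z′ : ℕ → Set ℓ₀} {d d′} →
                     (∀ {i} → 1 ≤ i → ¬ Z i → ¬ Z′ i) → (∀ {i} → 1 ≤ i → ¬ Z′ i → ¬ Z i) →
                     LastFailure Z d → LastFailure Z′ d′ → d ≡ d′
lastFailure-unique ¬Z⇒¬Z′ ¬Z′⇒¬Z last@(1≤d , ¬Zd , _) last′@(1≤d′ , ¬Z′d′ , _) =
  ℕₚ.≤-antisym (lastFailure-≤ last′ (¬Z⇒¬Z′ 1≤d ¬Zd)) (lastFailure-≤ last (¬Z′⇒¬Z 1≤d′ ¬Z′d′))

¬¬-∀-cofinite : {P : ℕ → Set ℓ₀} (N : ℕ) → (∀ j → N < j → P j) → (∀ j → ¬ ¬ P j) → ¬ ¬ (∀ j → P j)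
¬¬-∀-cofinite zero beyond ¬¬P k = do
  p0 ← ¬¬P 0
  k λ { zero → p0 ; (suc j) → beyond (suc j) (s≤s z≤n) }
¬¬-∀-cofinite (suc N) beyond ¬¬P k = do
  pN ← ¬¬P (suc N)
  ¬¬-∀-cofinite N (step-down pN beyond) ¬¬P k

-- Arithmetic of natural numbers

module _ where
  open Nat using (_+_; _*_; _^_; _∸_; ∣_-_∣)
  open ≡ using (refl; sym; trans; cong; cong₂; subst; subst₂; module ≡-Reasoning)
  open ℕ∣ using (_∣_; divides; ∣-trans; ∣-refl; _∣?_)
  open import Data.Integer as ℤ using (+_)
  import Data.Integer.Properties as ℤₚ

  infix 4 _^_∥_
  record _^_∥_ (q e x : ℕ) : Set where
    constructor exactly
    field
      power∣ : q ^ e ∣ x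
      power∤ : ¬ q ^ suc e ∣ x

  ^-positive : ∀ x e → 1 ≤ x → 1 ≤ x ^ e
  ^-positive x e 1≤x = ℕₚ.m^n>0 x {{>-nonZero 1≤x}} e

  ^-distribʳ-* : ∀ x y e → (x * y) ^ e ≡ x ^ e * y ^ e
  ^-distribʳ-* x y zero    = refl
  ^-distribʳ-* x y (suc e) = trans (cong (x * y *_) (^-distribʳ-* x y e)) (interchange x y (x ^ e) (y ^ e))
    where
    interchange : ∀ a b c d → a * b * (c * d) ≡ a * c * (b * d)
    interchange = solve-∀

  larger-factor-of-< : ∀ {a b j l} → a * b < j * l → a < j ⊎ b < l
  larger-factor-of-< {a} {b} {j} {l} ab<jl with a <? j | b <? l
  ... | yes a<j | _       = inj₁ a<j
  ... | no  _   | yes b<l = inj₂ b<l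
  ... | no  a≮j | no  b≮l = ⊥-elim (<⇒≱ ab<jl (ℕₚ.*-mono-≤ (≮⇒≥ a≮j) (≮⇒≥ b≮l)))

  larger-factor-of-≡ : ∀ {a b j l} → 1 ≤ l → j * l ≡ a * b → j ≢ a → a < j ⊎ b < l
  larger-factor-of-≡ {a} {b} {j} {l} 1≤l jl≡ab j≢a with a <? j | b <? l
  ... | yes a<j | _       = inj₁ a<j
  ... | no  _   | yes b<l = inj₂ b<l
  ... | no  a≮j | no  b≮l = ⊥-elim (<⇒≱ jl<ab (≤-reflexive (sym jl≡ab)))
    where
    jl<ab : j * l < a * b
    jl<ab = <-≤-trans (ℕₚ.*-monoˡ-< l {{>-nonZero 1≤l}} (≤∧≢⇒< (≮⇒≥ a≮j) j≢a)) (ℕₚ.*-monoʳ-≤ a (≮⇒≥ b≮l))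

  ^-∣-^ : ∀ q {i j} → i ≤ j → q ^ i ∣ q ^ j
  ^-∣-^ q {i} {j} i≤j = divides (q ^ (j ∸ i)) (begin
    q ^ j               ≡⟨ cong (q ^_) (sym (ℕₚ.m+[n∸m]≡n i≤j)) ⟩
    q ^ (i + (j ∸ i))   ≡⟨ ℕₚ.^-distribˡ-+-* q i (j ∸ i) ⟩
    q ^ i * q ^ (j ∸ i) ≡⟨ ℕₚ.*-comm (q ^ i) _ ⟩
    q ^ (j ∸ i) * q ^ i ∎)
    where open ≡-Reasoning

  valAux-∥ : ∀ fuel q x → 2 ≤ q → 1 ≤ x → x ≤ fuel → q ^ valAux fuel q x ∥ x
  valAux-∥ zero    q x _   1≤x x≤0 = ⊥-elim (<⇒≱ (≤-trans 1≤x x≤0) z≤n)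
  valAux-∥ (suc fuel) q x 2≤q 1≤x x≤fuel with q ∣? x
  ... | no q∤x =
    exactly (divides x (sym (ℕₚ.*-identityʳ x))) λ q∣x → q∤x (subst (_∣ x) (ℕₚ.*-identityʳ q) q∣x)
  ... | yes (divides y refl) = exactly ∣-step ∤-step
    where
    1≤y : 1 ≤ y
    1≤y = Nat.>-nonZero⁻¹ y {{ℕₚ.m*n≢0⇒m≢0 y {{>-nonZero 1≤x}}}}
    y<y*q : y < y * q
    y<y*q = subst (_< y * q) (ℕₚ.*-identityʳ y) (ℕₚ.*-monoʳ-< y {{>-nonZero 1≤y}} 2≤q)
    e = valAux fuel q y
    IH : q ^ e ∥ y
    IH = valAux-∥ fuel q y 2≤q 1≤y (≤-pred (≤-trans y<y*q x≤fuel))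
    ∣-step : q ^ suc e ∣ y * q
    ∣-step = subst (_∣ y * q) (ℕₚ.*-comm (q ^ e) q) (ℕ∣.*-pres-∣ (_^_∥_.power∣ IH) (∣-refl {q}))
    ∤-step : ¬ q ^ suc (suc e) ∣ y * q
    ∤-step q^e+2∣yq = _^_∥_.power∤ IH (ℕ∣.*-cancelʳ-∣ q {{>-nonZero (≤-trans (s≤s z≤n) 2≤q)}}
                        (subst (_∣ y * q) (ℕₚ.*-comm q (q ^ suc e)) q^e+2∣yq))

  ν-∥ : ∀ {q x} → Prime q → 1 ≤ x → q ^ ν q x ∥ x
  ν-∥ {q} {x} q-prime 1≤x =
    valAux-∥ x q x (Nat.nonTrivial⇒n>1 q {{prime⇒nonTrivial q-prime}}) 1≤x ≤-refl

  ∥-unique : ∀ {q e e′ x} → q ^ e ∥ x → q ^ e′ ∥ x → e ≡ e′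
  ∥-unique {q} {e} {e′} (exactly ∣x ∤x) (exactly ∣′x ∤′x) with <-cmp e e′
  ... | tri< e<e′ _ _ = ⊥-elim (∤x (∣-trans (^-∣-^ q e<e′) ∣′x))
  ... | tri≈ _ e≡e′ _ = e≡e′
  ... | tri> _ _ e′<e = ⊥-elim (∤′x (∣-trans (^-∣-^ q e′<e) ∣x))

  ∥-* : ∀ {q e e′ x y} → Prime q → q ^ e ∥ x → q ^ e′ ∥ y → q ^ (e + e′) ∥ x * y
  ∥-* {q} {e} {e′} q-prime (exactly (divides x′ refl) ∤x) (exactly (divides y′ refl) ∤y) =
    exactly ∣xy ∤xy
    where
    instance
      _ = prime⇒nonZero q-prime
      _ = ℕₚ.m^n≢0 q (e + e′)
    factor : x′ * q ^ e * (y′ * q ^ e′) ≡ (x′ * y′) * q ^ (e + e′)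
    factor = trans (rearrange x′ (q ^ e) y′ (q ^ e′)) (cong ((x′ * y′) *_) (sym (ℕₚ.^-distribˡ-+-* q e e′)))
      where rearrange : ∀ a b c d → a * b * (c * d) ≡ a * c * (b * d)
            rearrange = solve-∀
    ∣xy : q ^ (e + e′) ∣ x′ * q ^ e * (y′ * q ^ e′)
    ∣xy = divides (x′ * y′) factor
    q∤ : ∀ {z f} → ¬ q ^ suc f ∣ z * q ^ f → ¬ q ∣ z
    q∤ {z} {f} ∤ q∣z = ∤ (subst₂ _∣_ (ℕₚ.*-comm (q ^ f) q) (ℕₚ.*-comm (q ^ f) z) (ℕ∣.*-monoʳ-∣ (q ^ f) q∣z))
    ∤xy : ¬ q ^ suc (e + e′) ∣ x′ * q ^ e * (y′ * q ^ e′)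
    ∤xy ∣ with euclidsLemma x′ y′ q-prime
                 (ℕ∣.*-cancelʳ-∣ (q ^ (e + e′)) (subst (q ^ suc (e + e′) ∣_) factor ∣))
    ... | inj₁ q∣x′ = q∤ {f = e} ∤x q∣x′
    ... | inj₂ q∣y′ = q∤ {f = e′} ∤y q∣y′

  ν-* : ∀ {q x y} → Prime q → 1 ≤ x → 1 ≤ y → ν q (x * y) ≡ ν q x + ν q y
  ν-* q-prime 1≤x 1≤y =
    ∥-unique (ν-∥ q-prime (ℕₚ.*-mono-≤ 1≤x 1≤y)) (∥-* q-prime (ν-∥ q-prime 1≤x) (ν-∥ q-prime 1≤y))

  ν-^ : ∀ {q x} e → Prime q → 1 ≤ x → ν q (x ^ e) ≡ e * ν q x
  ν-^ {q} zero q-prime _ = ∥-unique (ν-∥ q-prime ≤-refl) (exactly ∣-refl q∤1)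
    where
    q∤1 : ¬ q ^ 1 ∣ 1
    q∤1 q∣1 = <⇒≱ (Nat.nonTrivial⇒n>1 q {{prime⇒nonTrivial q-prime}})
                     (≤-reflexive (trans (sym (ℕₚ.*-identityʳ q)) (ℕ∣.∣1⇒≡1 q∣1)))
  ν-^ {q} {x} (suc e) q-prime 1≤x = trans (ν-* q-prime 1≤x (^-positive x e 1≤x))
                                         (cong (λ t → ν q x + t) (ν-^ e q-prime 1≤x))

  ∣+m-+n∣≡∣m-n∣ : ∀ m n → ℤ.∣ + m ℤ.- + n ∣ ≡ ∣ m - n ∣
  ∣+m-+n∣≡∣m-n∣ m n with ℕₚ.≤-total m n
  ... | inj₁ m≤n = trans (cong ℤ.∣_∣ (ℤₚ.m-n≡m⊖n m n))
                     (trans (ℤₚ.∣⊖∣-≤ m≤n) (sym (ℕₚ.m≤n⇒∣m-n∣≡n∸m m≤n)))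
  ... | inj₂ n≤m = trans (cong ℤ.∣_∣ (ℤₚ.m-n≡m⊖n m n))
                     (trans (ℤₚ.∣m⊖n∣≡∣n⊖m∣ m n) (trans (ℤₚ.∣⊖∣-≤ n≤m) (sym (ℕₚ.m≤n⇒∣n-m∣≡n∸m n≤m))))

  *-∣-∣-balance : ∀ j k x y z w → j * x + k * y ≡ j * z + k * w → j * ∣ z - x ∣ ≡ k * ∣ y - w ∣
  *-∣-∣-balance j k x y z w eq = begin
    j * ∣ z - x ∣                       ≡⟨ ℕₚ.*-distribˡ-∣-∣ j z x ⟩
    ∣ j * z - j * x ∣                   ≡⟨ ℕₚ.∣m+n-m+o∣≡∣n-o∣ (k * w) (j * z) (j * x) ⟨
    ∣ k * w + j * z - k * w + j * x ∣   ≡⟨ cong₂ ∣_-_∣ (ℕₚ.+-comm (k * w) _) (ℕₚ.+-comm (k * w) _) ⟩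
    ∣ j * z + k * w - j * x + k * w ∣   ≡⟨ cong (∣_- j * x + k * w ∣) (sym eq) ⟩
    ∣ j * x + k * y - j * x + k * w ∣   ≡⟨ ℕₚ.∣m+n-m+o∣≡∣n-o∣ (j * x) (k * y) (k * w) ⟩
    ∣ k * y - k * w ∣                   ≡⟨ ℕₚ.*-distribˡ-∣-∣ k y w ⟨
    k * ∣ y - w ∣                       ∎
    where open ≡-Reasoning

  ExponentCondition : ℕ → ℕ → ℕ → Set
  ExponentCondition m n k =
    ∀ d → d ∣ k → (∀ q → Prime q → q ∣ m * n → d ∣ ℤ.∣ + ν q n ℤ.- + ν q m ∣) → d ≡ 1

  -- Comparing q-adic valuations gives k ∣ j (ν_q n - ν_q m) for every q; divide k by gcd(k, j).
  ∣-from-power-identity : ∀ {m n k j a d} → ExponentCondition m n k → 1 ≤ k →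
    1 ≤ m → 1 ≤ n → 1 ≤ a → 1 ≤ d → m ^ j * d ^ k ≡ n ^ j * a ^ k → k ∣ j
  ∣-from-power-identity {m} {n} {k} {j} {a} {d} condition 1≤k 1≤m 1≤n 1≤a 1≤d eq =
    divides j′ (begin
      j             ≡⟨ j≡j′g ⟩
      j′ * g        ≡⟨ cong (j′ *_) (trans (sym (ℕₚ.*-identityˡ g)) (cong (_* g) (sym k′≡1))) ⟩
      j′ * (k′ * g) ≡⟨ cong (j′ *_) (sym k≡k′g) ⟩
      j′ * k        ∎)
    where
    open ≡-Reasoning
    Δ : ℕ → ℕ
    Δ q = ∣ ν q n - ν q m ∣
    ν-eq : ∀ {q} → Prime q → j * ν q m + k * ν q d ≡ j * ν q n + k * ν q a
    ν-eq {q} q-prime = begin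
      j * ν q m + k * ν q d     ≡⟨ cong₂ _+_ (ν-^ j q-prime 1≤m) (ν-^ k q-prime 1≤d) ⟨
      ν q (m ^ j) + ν q (d ^ k) ≡⟨ ν-* q-prime (^-positive m j 1≤m) (^-positive d k 1≤d) ⟨
      ν q (m ^ j * d ^ k)       ≡⟨ cong (ν q) eq ⟩
      ν q (n ^ j * a ^ k)       ≡⟨ ν-* q-prime (^-positive n j 1≤n) (^-positive a k 1≤a) ⟩
      ν q (n ^ j) + ν q (a ^ k) ≡⟨ cong₂ _+_ (ν-^ j q-prime 1≤n) (ν-^ k q-prime 1≤a) ⟩
      j * ν q n + k * ν q a     ∎
    k∣jΔ : ∀ {q} → Prime q → k ∣ j * Δ q
    k∣jΔ {q} q-prime = divides (∣ ν q d - ν q a ∣)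
      (trans (*-∣-∣-balance j k (ν q m) (ν q d) (ν q n) (ν q a) (ν-eq q-prime)) (ℕₚ.*-comm k _))
    g = gcd k j
    instance
      _ : NonZero g
      _ = Nat.≢-nonZero (gcd[m,n]≢0 k j (inj₁ λ k≡0 → <⇒≱ 1≤k (≤-reflexive k≡0)))
    k′ = ℕ∣.quotient (gcd[m,n]∣m k j)
    j′ = ℕ∣.quotient (gcd[m,n]∣n k j)
    k≡k′g : k ≡ k′ * g
    k≡k′g = ℕ∣._∣_.equality (gcd[m,n]∣m k j)
    j≡j′g : j ≡ j′ * g
    j≡j′g = ℕ∣._∣_.equality (gcd[m,n]∣n k j)
    coprime : Coprime k′ j′
    coprime {i} (i∣k′ , i∣j′) = ℕ∣.∣1⇒≡1 (ℕ∣.*-cancelʳ-∣ g (subst (i * g ∣_) (sym (ℕₚ.*-identityˡ g)) ig∣g))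
      where
      ig∣g : i * g ∣ g
      ig∣g = gcd-greatest (subst (i * g ∣_) (sym k≡k′g) (ℕ∣.*-monoˡ-∣ g i∣k′))
                          (subst (i * g ∣_) (sym j≡j′g) (ℕ∣.*-monoˡ-∣ g i∣j′))
    k′∣Δ : ∀ {q} → Prime q → k′ ∣ Δ q
    k′∣Δ {q} q-prime = coprime-divisor coprime (ℕ∣.*-cancelʳ-∣ g
      (subst₂ _∣_ k≡k′g (trans (cong (_* Δ q) j≡j′g) (rearrange j′ g (Δ q))) (k∣jΔ q-prime)))
      where rearrange : ∀ x y z → x * y * z ≡ x * z * y
            rearrange = solve-∀
    k′≡1 : k′ ≡ 1
    k′≡1 = condition k′ (divides g (trans k≡k′g (ℕₚ.*-comm k′ g)))
             (λ q q-prime _ → subst (k′ ∣_) (sym (∣+m-+n∣≡∣m-n∣ (ν q n) (ν q m))) (k′∣Δ q-prime))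

-- Fractions and the weight of a term

module _ where
  open Nat using (_+_; _*_; _^_)
  open ≡ using (refl; sym; trans; cong₂; subst₂)

  Fraction : Set
  Fraction = ℕ × ℕ

  numerator denominator : Fraction → ℕ
  numerator   = proj₁
  denominator = proj₂

  infix 4 _≤ᶠ_ _<ᶠ_
  record _≤ᶠ_ (x y : Fraction) : Set where
    constructor *≤*
    field cross≤ : numerator x * denominator y ≤ numerator y * denominator x

  record _<ᶠ_ (x y : Fraction) : Set where
    constructor *<*
    field cross< : numerator x * denominator y < numerator y * denominator x

  infixl 7 _⊗_
  _⊗_ : Fraction → Fraction → Fraction
  (a , b) ⊗ (c , d) = a * c , b * d

  Positive : Fraction → Set
  Positive (a , b) = 1 ≤ a × 1 ≤ b

  ≤ᶠ-refl : ∀ {x} → x ≤ᶠ x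
  ≤ᶠ-refl = *≤* ≤-refl

  ≤ᶠ-total : ∀ x y → x ≤ᶠ y ⊎ y <ᶠ x
  ≤ᶠ-total (a , b) (c , d) with a * d ≤? c * b
  ... | yes ad≤cb = inj₁ (*≤* ad≤cb)
  ... | no  ad≰cb = inj₂ (*<* (≰⇒> ad≰cb))

  <ᶠ⇒≤ᶠ : ∀ {x y} → x <ᶠ y → x ≤ᶠ y
  <ᶠ⇒≤ᶠ (*<* x<y) = *≤* (<⇒≤ x<y)

  ≤ᶠ⇒≯ᶠ : ∀ {x y} → x ≤ᶠ y → ¬ y <ᶠ x
  ≤ᶠ⇒≯ᶠ (*≤* x≤y) (*<* y<x) = <⇒≱ y<x x≤y

  private
    interchange : ∀ a b c d → a * b * (c * d) ≡ a * c * (b * d)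
    interchange = solve-∀

  ≤ᶠ-trans : ∀ {x y z} → Positive y → x ≤ᶠ y → y ≤ᶠ z → x ≤ᶠ z
  ≤ᶠ-trans {a , b} {c , d} {e , f} (1≤c , 1≤d) (*≤* ad≤cb) (*≤* cf≤ed) =
    *≤* (ℕₚ.*-cancelʳ-≤ (a * f) (e * b) (c * d) {{>-nonZero (ℕₚ.*-mono-≤ 1≤c 1≤d)}}
         (subst₂ _≤_ (rearrangeˡ a c d f) (rearrangeʳ b c d e) (ℕₚ.*-mono-≤ ad≤cb cf≤ed)))
    where
    rearrangeˡ : ∀ a c d f → a * d * (c * f) ≡ a * f * (c * d)
    rearrangeˡ = solve-∀
    rearrangeʳ : ∀ b c d e → c * b * (e * d) ≡ e * b * (c * d)
    rearrangeʳ = solve-∀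

  ⊗-mono-≤ᶠ : ∀ {x y x′ y′} → x ≤ᶠ y → x′ ≤ᶠ y′ → x ⊗ x′ ≤ᶠ y ⊗ y′
  ⊗-mono-≤ᶠ {a , b} {c , d} {a′ , b′} {c′ , d′} (*≤* x≤y) (*≤* x′≤y′) =
    *≤* (subst₂ _≤_ (interchange a d a′ d′) (interchange c b c′ b′) (ℕₚ.*-mono-≤ x≤y x′≤y′))

  ⊗-mono-<ᶠ-≤ᶠ : ∀ {x y x′ y′} → Positive x′ → Positive y′ → x <ᶠ y → x′ ≤ᶠ y′ → x ⊗ x′ <ᶠ y ⊗ y′
  ⊗-mono-<ᶠ-≤ᶠ {a , b} {c , d} {a′ , b′} {c′ , d′} (1≤a′ , _) (_ , 1≤d′) (*<* x<y) (*≤* x′≤y′) =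
    *<* (subst₂ _<_ (interchange a d a′ d′) (interchange c b c′ b′)
         (<-≤-trans (ℕₚ.*-monoˡ-< (a′ * d′) {{>-nonZero (ℕₚ.*-mono-≤ 1≤a′ 1≤d′)}} x<y)
                    (ℕₚ.*-monoʳ-≤ (c * b) x′≤y′)))

  ⊗-comm : ∀ x y → x ⊗ y ≡ y ⊗ x
  ⊗-comm (a , b) (c , d) = cong₂ _,_ (ℕₚ.*-comm a c) (ℕₚ.*-comm b d)

  ⊗-mono-≤ᶠ-<ᶠ : ∀ {x y x′ y′} → Positive x → Positive y → x ≤ᶠ y → x′ <ᶠ y′ → x ⊗ x′ <ᶠ y ⊗ y′
  ⊗-mono-≤ᶠ-<ᶠ {x} {y} {x′} {y′} x⁺ y⁺ x≤y x′<y′ =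
    subst₂ _<ᶠ_ (⊗-comm x′ x) (⊗-comm y′ y) (⊗-mono-<ᶠ-≤ᶠ x⁺ y⁺ x′<y′ x≤y)

  ⊗-tight : ∀ {x y u v} → Positive y → Positive v → x ≤ᶠ u → y ≤ᶠ v → u ⊗ v ≤ᶠ x ⊗ y → u ≤ᶠ x
  ⊗-tight {x} {y} {u} {v} y⁺ v⁺ x≤u y≤v uv≤xy with ≤ᶠ-total u x
  ... | inj₁ u≤x = u≤x
  ... | inj₂ x<u = ⊥-elim (≤ᶠ⇒≯ᶠ uv≤xy (⊗-mono-<ᶠ-≤ᶠ y⁺ v⁺ x<u y≤v))

-- The weight of a term of index i whose coefficient is exactly divisible by p^e.
module Weight (m n k : ℕ) where
  open Nat using (_+_; _*_; _^_; _∸_)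
  open ≡ using (refl; sym; cong; cong₂; subst₂; module ≡-Reasoning)

  weight : ℕ × ℕ → Fraction
  weight (i , e) = n ^ e , m ^ e * i ^ k

  weight-positive : 1 ≤ m → 1 ≤ n → ∀ {i} e → 1 ≤ i → Positive (weight (i , e))
  weight-positive 1≤m 1≤n {i} e 1≤i =
    ^-positive n e 1≤n , ℕₚ.*-mono-≤ (^-positive m e 1≤m) (^-positive i k 1≤i)

  weight-* : ∀ i j e f → weight (i * j , e + f) ≡ weight (i , e) ⊗ weight (j , f)
  weight-* i j e f = cong₂ _,_ (ℕₚ.^-distribˡ-+-* n e f) (begin
    m ^ (e + f) * (i * j) ^ k               ≡⟨ cong₂ _*_ (ℕₚ.^-distribˡ-+-* m e f) (^-distribʳ-* i j k) ⟩
    m ^ e * m ^ f * (i ^ k * j ^ k)         ≡⟨ interchange (m ^ e) (m ^ f) (i ^ k) (j ^ k) ⟩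
    m ^ e * i ^ k * (m ^ f * j ^ k)         ∎)
    where
    open ≡-Reasoning
    interchange : ∀ a b c d → a * b * (c * d) ≡ a * c * (b * d)
    interchange = solve-∀

  weight-antitone : m ≤ n → ∀ {i j e f} → j ≤ i → e ≤ f → weight (i , e) ≤ᶠ weight (j , f)
  weight-antitone m≤n {i} {j} {e} {f} j≤i e≤f =
    *≤* (subst₂ _≤_ (rearrange (n ^ e) (m ^ f) (j ^ k)) (rearrange (n ^ f) (m ^ e) (i ^ k))
          (ℕₚ.*-mono-≤ exponents (ℕₚ.^-monoˡ-≤ k j≤i)))
    where
    rearrange : ∀ a b c → a * b * c ≡ a * (b * c)
    rearrange = solve-∀
    exponents : n ^ e * m ^ f ≤ n ^ f * m ^ e
    exponents = begin
      n ^ e * m ^ f             ≡⟨ cong (λ t → n ^ e * m ^ t) f≡e+d ⟩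
      n ^ e * m ^ (e + d)       ≡⟨ cong (n ^ e *_) (ℕₚ.^-distribˡ-+-* m e d) ⟩
      n ^ e * (m ^ e * m ^ d)   ≤⟨ ℕₚ.*-monoʳ-≤ (n ^ e) (ℕₚ.*-monoʳ-≤ (m ^ e) (ℕₚ.^-monoˡ-≤ d m≤n)) ⟩
      n ^ e * (m ^ e * n ^ d)   ≡⟨ swap (n ^ e) (m ^ e) (n ^ d) ⟩
      n ^ e * n ^ d * m ^ e     ≡⟨ cong (_* m ^ e) (ℕₚ.^-distribˡ-+-* n e d) ⟨
      n ^ (e + d) * m ^ e       ≡⟨ cong (λ t → n ^ t * m ^ e) f≡e+d ⟨
      n ^ f * m ^ e             ∎
      where
      open ℕₚ.≤-Reasoning
      d = f ∸ e
      f≡e+d : f ≡ e + d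
      f≡e+d = sym (ℕₚ.m+[n∸m]≡n e≤f)
      swap : ∀ a b c → a * (b * c) ≡ a * c * b
      swap = solve-∀

  weight-exponent-< : m ≤ n → ∀ {i e f} → weight (i , e) <ᶠ weight (i , f) → e < f
  weight-exponent-< m≤n {i} {e} {f} lighter with e <? f
  ... | yes e<f = e<f
  ... | no  e≮f = ⊥-elim (≤ᶠ⇒≯ᶠ (weight-antitone m≤n {i} {i} {f} {e} ≤-refl (≮⇒≥ e≮f)) lighter)

  weight-m,0≤n,k : weight (m , 0) ≤ᶠ weight (n , k)
  weight-m,0≤n,k = *≤* (≤-reflexive (swap (m ^ k) (n ^ k)))
    where
    swap : ∀ a b → 1 * (a * b) ≡ b * (1 * a)
    swap = solve-∀

  weight-n,k≤m,0 : weight (n , k) ≤ᶠ weight (m , 0)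
  weight-n,k≤m,0 = *≤* (≤-reflexive (swap (m ^ k) (n ^ k)))
    where
    swap : ∀ a b → b * (1 * a) ≡ 1 * (a * b)
    swap = solve-∀

  weight-equal : ∀ {a d j} → weight (a , 0) ≤ᶠ weight (d , j) → weight (d , j) ≤ᶠ weight (a , 0) →
                 m ^ j * d ^ k ≡ n ^ j * a ^ k
  weight-equal {a} {d} {j} (*≤* a≤d) (*≤* d≤a) = ℕₚ.≤-antisym
    (subst₂ _≤_ (ℕₚ.*-identityˡ _) (cong (n ^ j *_) (ℕₚ.*-identityˡ _)) a≤d)
    (subst₂ _≤_ (cong (n ^ j *_) (ℕₚ.*-identityˡ _)) (ℕₚ.*-identityˡ _) d≤a)

-- Divisibility and Dirichlet products in a commutative ring

module RingLemmas {c ℓ} (R : CommutativeRing c ℓ) where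
  open CommutativeRing R
  open CommutativeSemigroupProperties *-commutativeSemigroup using (interchange; x∙yz≈y∙xz)
  module + = CommutativeSemigroupProperties +-commutativeSemigroup
  open AbelianGroupProperties +-abelianGroup using (xyx⁻¹≈y)
  open RingProperties ring using (x[y-z]≈xy-xz)
  open import Relation.Binary.Reasoning.Setoid setoid

  infix 4 _∣_ _≈_mod_
  _∣_ : Carrier → Carrier → Set (c ⊔ ℓ)
  _∣_ = Divides R

  _≈_mod_ : Carrier → Carrier → Carrier → Set (c ⊔ ℓ)
  x ≈ y mod Q = ∃ λ z → x ≈ Q * z + y

  private variable
    a b d x y Q : Carrier

  ∣-refl : a ∣ a
  ∣-refl {a} = 1# , sym (*-identityʳ a)

  ∣-trans : a ∣ b → b ∣ d → a ∣ d
  ∣-trans {a} (x , b≈ax) (y , d≈by) = x * y , trans d≈by (trans (*-congʳ b≈ax) (*-assoc a x y))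

  ∣-respʳ : b ≈ d → a ∣ b → a ∣ d
  ∣-respʳ b≈d (x , b≈ax) = x , trans (sym b≈d) b≈ax

  ∣-respˡ : a ≈ d → a ∣ b → d ∣ b
  ∣-respˡ a≈d (x , b≈ax) = x , trans b≈ax (*-congʳ a≈d)

  ∣0 : a ∣ 0#
  ∣0 {a} = 0# , sym (zeroʳ a)

  ∣-+ : a ∣ b → a ∣ d → a ∣ b + d
  ∣-+ {a} (x , b≈ax) (y , d≈ay) = x + y , trans (+-cong b≈ax d≈ay) (sym (distribˡ a x y))

  ∣-*ʳ : ∀ d → a ∣ b → a ∣ b * d
  ∣-*ʳ {a} d (x , b≈ax) = x * d , trans (*-congʳ b≈ax) (*-assoc a x d)

  ∣-*ˡ : ∀ d → a ∣ b → a ∣ d * b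
  ∣-*ˡ {a} d (x , b≈ax) = d * x , trans (*-congˡ b≈ax) (x∙yz≈y∙xz d a x)

  0∣⇒≈0 : 0# ∣ x → x ≈ 0#
  0∣⇒≈0 (y , x≈0y) = trans x≈0y (zeroˡ y)

  ≈0⇒0∣ : x ≈ 0# → 0# ∣ x
  ≈0⇒0∣ x≈0 = 0# , trans x≈0 (sym (zeroˡ 0#))

  ≈mod-∣ : x ≈ y mod Q → Q ∣ x → Q ∣ y
  ≈mod-∣ {x} {y} {Q} (z , x≈Qz+y) (w , x≈Qw) = w - z , (begin
    y                   ≈⟨ xyx⁻¹≈y (Q * z) y ⟨
    Q * z + y - Q * z   ≈⟨ +-congʳ x≈Qz+y ⟨
    x - Q * z           ≈⟨ +-congʳ x≈Qw ⟩
    Q * w - Q * z       ≈⟨ x[y-z]≈xy-xz Q w z ⟨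
    Q * (w - z)         ∎)

  +-≈mod : Q ∣ y → x + y ≈ x mod Q
  +-≈mod {Q} {y} {x} (z , y≈Qz) = z , trans (+-comm x y) (+-congʳ y≈Qz)

  ≈mod0⇒≈ : x ≈ y mod 0# → x ≈ y
  ≈mod0⇒≈ {x} {y} (z , x≈0z+y) = trans x≈0z+y (trans (+-congʳ (zeroˡ z)) (+-identityˡ y))

  pow-+ : ∀ a i j → pow R a (i Nat.+ j) ≈ pow R a i * pow R a j
  pow-+ a zero    j = sym (*-identityˡ _)
  pow-+ a (suc i) j = trans (*-congˡ (pow-+ a i j)) (sym (*-assoc a _ _))

  pow-∣ : ∀ a {i j} → i ≤ j → pow R a i ∣ pow R a j
  pow-∣ a {i} {j} i≤j = pow R a (j Nat.∸ i) ,
    trans (reflexive (≡.cong (pow R a) (≡.sym (ℕₚ.m+[n∸m]≡n i≤j)))) (pow-+ a i (j Nat.∸ i))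

  prodL-++ : ∀ xs ys → prodL R (xs ++ ys) ≈ prodL R xs * prodL R ys
  prodL-++ []       ys = sym (*-identityˡ _)
  prodL-++ (x ∷ xs) ys = trans (*-congˡ (prodL-++ xs ys)) (sym (*-assoc x _ _))

  prodL-replicate : ∀ e x → prodL R (replicate e x) ≈ pow R x e
  prodL-replicate zero    x = refl
  prodL-replicate (suc e) x = *-congˡ (prodL-replicate e x)

  sumTo-cong : ∀ {h h′ : ℕ → Carrier} N → (∀ j → 1 ≤ j → j ≤ N → h j ≈ h′ j) →
               sumTo R h N ≈ sumTo R h′ N
  sumTo-cong zero    h≈h′ = refl
  sumTo-cong (suc N) h≈h′ =
    +-cong (sumTo-cong N λ j 1≤j j≤N → h≈h′ j 1≤j (m≤n⇒m≤1+n j≤N)) (h≈h′ (suc N) (s≤s z≤n) ≤-refl)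

  sumTo-∣ : ∀ {h : ℕ → Carrier} N → (∀ j → 1 ≤ j → j ≤ N → Q ∣ h j) → Q ∣ sumTo R h N
  sumTo-∣ zero    Q∣h = ∣0
  sumTo-∣ (suc N) Q∣h =
    ∣-+ (sumTo-∣ N λ j 1≤j j≤N → Q∣h j 1≤j (m≤n⇒m≤1+n j≤N)) (Q∣h (suc N) (s≤s z≤n) ≤-refl)

  sumTo-single : ∀ {h : ℕ → Carrier} N {j₀} → 1 ≤ j₀ → j₀ ≤ N →
                 (∀ j → 1 ≤ j → j ≤ N → j ≢ j₀ → Q ∣ h j) → sumTo R h N ≈ h j₀ mod Q
  sumTo-single zero 1≤j₀ j₀≤0 _ = ⊥-elim (<⇒≱ 1≤j₀ j₀≤0)
  sumTo-single {Q} {h} (suc N) {j₀} 1≤j₀ j₀≤N+1 Q∣h with suc N ≟ j₀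
  ... | yes ≡.refl = proj₁ rest , +-congʳ (proj₂ rest)
    where
    rest : Q ∣ sumTo R h N
    rest = sumTo-∣ N λ j 1≤j j≤N → Q∣h j 1≤j (m≤n⇒m≤1+n j≤N) (λ { ≡.refl → <⇒≱ (s≤s j≤N) ≤-refl })
  ... | no N+1≢j₀ = z + w , (begin
    sumTo R h N + h (suc N)   ≈⟨ +-cong sum≈Qz+h hN≈Qw ⟩
    Q * z + h j₀ + Q * w      ≈⟨ +.xy∙z≈xz∙y (Q * z) (h j₀) (Q * w) ⟩
    Q * z + Q * w + h j₀      ≈⟨ +-congʳ (distribˡ Q z w) ⟨
    Q * (z + w) + h j₀        ∎)
    where
    IH = sumTo-single N 1≤j₀ (≤-pred (≤∧≢⇒< j₀≤N+1 (λ e → N+1≢j₀ (≡.sym e))))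
                      λ j 1≤j j≤N → Q∣h j 1≤j (m≤n⇒m≤1+n j≤N)
    z = proj₁ IH
    sum≈Qz+h = proj₂ IH
    last = Q∣h (suc N) (s≤s z≤n) ≤-refl N+1≢j₀
    w = proj₁ last
    hN≈Qw = proj₂ last

  *-sumTo : ∀ a (h : ℕ → Carrier) N → a * sumTo R h N ≈ sumTo R (λ j → a * h j) N
  *-sumTo a h zero    = zeroʳ a
  *-sumTo a h (suc N) = trans (distribˡ a _ _) (+-congʳ (*-sumTo a h N))

  -- dirMulCoeff R u v unfolds to coeff u ⋆ coeff v.
  ⋆-term : (U V : ℕ → Carrier) → ℕ → ℕ → ℕ → Carrier
  ⋆-term U V I j l = if j Nat.* l ≡ᵇ I then U j * V l else 0#

  infixl 7 _⋆_
  _⋆_ : (ℕ → Carrier) → (ℕ → Carrier) → ℕ → Carrier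
  (U ⋆ V) I = sumTo R (λ j → sumTo R (⋆-term U V I j) I) I

  private variable
    U U′ V V′ : ℕ → Carrier
    I j l : ℕ

  ⋆-term-∣ : ∀ U V j l → (j Nat.* l ≡ I → Q ∣ U j * V l) → Q ∣ ⋆-term U V I j l
  ⋆-term-∣ {I} U V j l Q∣UV with j Nat.* l ≡ᵇ I in jl≡ᵇI
  ... | true  = Q∣UV (ℕₚ.≡ᵇ⇒≡ (j Nat.* l) I (≡.subst T (≡.sym jl≡ᵇI) tt))
  ... | false = ∣0

  ⋆-term-≡ : ∀ U V → j Nat.* l ≡ I → ⋆-term U V I j l ≈ U j * V l
  ⋆-term-≡ {j} {l} {I} U V jl≡I with j Nat.* l ≡ᵇ I in jl≡ᵇI
  ... | true  = refl
  ... | false = ⊥-elim (≡.subst T jl≡ᵇI (ℕₚ.≡⇒≡ᵇ (j Nat.* l) I jl≡I))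

  ⋆-term-cong : (∀ j → 1 ≤ j → U j ≈ U′ j) → (∀ l → 1 ≤ l → V l ≈ V′ l) → 1 ≤ j → 1 ≤ l →
                ⋆-term U V I j l ≈ ⋆-term U′ V′ I j l
  ⋆-term-cong {j = j} {l} {I} U≈U′ V≈V′ 1≤j 1≤l with j Nat.* l ≡ᵇ I
  ... | true  = *-cong (U≈U′ j 1≤j) (V≈V′ l 1≤l)
  ... | false = refl

  ⋆-term-scale : ∀ a b U V j l → ⋆-term (λ j → a * U j) (λ l → b * V l) I j l ≈ (a * b) * ⋆-term U V I j l
  ⋆-term-scale {I} a b U V j l with j Nat.* l ≡ᵇ I
  ... | true  = interchange a (U j) b (V l)
  ... | false = sym (zeroʳ (a * b))

  ⋆-∣ : (∀ j l → 1 ≤ j → 1 ≤ l → j Nat.* l ≡ I → Q ∣ U j * V l) → Q ∣ (U ⋆ V) I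
  ⋆-∣ {I} {Q} {U} {V} Q∣UV =
    sumTo-∣ I λ j 1≤j _ → sumTo-∣ I λ l 1≤l _ → ⋆-term-∣ U V j l (Q∣UV j l 1≤j 1≤l)

  ⋆-single : ∀ {j₀ l₀} → 1 ≤ j₀ → 1 ≤ l₀ → j₀ Nat.* l₀ ≡ I →
             (∀ j l → 1 ≤ j → 1 ≤ l → j Nat.* l ≡ I → j ≢ j₀ → Q ∣ U j * V l) →
             (U ⋆ V) I ≈ U j₀ * V l₀ mod Q
  ⋆-single {I} {Q} {U} {V} {j₀} {l₀} 1≤j₀ 1≤l₀ j₀l₀≡I Q∣UV =
    proj₁ inner + proj₁ outer , (begin
      (U ⋆ V) I                                                ≈⟨ proj₂ outer ⟩
      Q * proj₁ outer + sumTo R (⋆-term U V I j₀) I            ≈⟨ +-congˡ (proj₂ inner) ⟩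
      Q * proj₁ outer + (Q * proj₁ inner + ⋆-term U V I j₀ l₀) ≈⟨ +-assoc _ _ _ ⟨
      Q * proj₁ outer + Q * proj₁ inner + ⋆-term U V I j₀ l₀   ≈⟨ +-cong (+-comm _ _) (⋆-term-≡ U V j₀l₀≡I) ⟩
      Q * proj₁ inner + Q * proj₁ outer + U j₀ * V l₀          ≈⟨ +-congʳ (distribˡ Q _ _) ⟨
      Q * (proj₁ inner + proj₁ outer) + U j₀ * V l₀            ∎)
    where
    j₀≤I : j₀ ≤ I
    j₀≤I = ≡.subst (j₀ ≤_) j₀l₀≡I (ℕₚ.m≤m*n j₀ l₀ {{>-nonZero 1≤l₀}})
    l₀≤I : l₀ ≤ I
    l₀≤I = ≡.subst (l₀ ≤_) j₀l₀≡I (ℕₚ.m≤n*m l₀ j₀ {{>-nonZero 1≤j₀}})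
    outer = sumTo-single I 1≤j₀ j₀≤I λ j 1≤j _ j≢j₀ →
              sumTo-∣ I λ l 1≤l _ → ⋆-term-∣ U V j l λ jl≡I → Q∣UV j l 1≤j 1≤l jl≡I j≢j₀
    inner = sumTo-single I 1≤l₀ l₀≤I λ l 1≤l _ l≢l₀ →
              ⋆-term-∣ U V j₀ l λ j₀l≡I →
                ⊥-elim (l≢l₀ (ℕₚ.*-cancelˡ-≡ l l₀ j₀ {{>-nonZero 1≤j₀}} (≡.trans j₀l≡I (≡.sym j₀l₀≡I))))

  ⋆-cong : (∀ j → 1 ≤ j → U j ≈ U′ j) → (∀ l → 1 ≤ l → V l ≈ V′ l) → ∀ I → (U ⋆ V) I ≈ (U′ ⋆ V′) I
  ⋆-cong U≈U′ V≈V′ I = sumTo-cong I λ j 1≤j _ → sumTo-cong I λ l 1≤l _ → ⋆-term-cong U≈U′ V≈V′ 1≤j 1≤l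

  ⋆-scale : ∀ a b U V I → ((λ j → a * U j) ⋆ (λ l → b * V l)) I ≈ (a * b) * (U ⋆ V) I
  ⋆-scale a b U V I = begin
    ((λ j → a * U j) ⋆ (λ l → b * V l)) I
      ≈⟨ sumTo-cong I (λ j _ _ → sumTo-cong I λ l _ _ → ⋆-term-scale a b U V j l) ⟩
    sumTo R (λ j → sumTo R (λ l → (a * b) * ⋆-term U V I j l) I) I
      ≈⟨ sumTo-cong I (λ j _ _ → *-sumTo (a * b) _ I) ⟨
    sumTo R (λ j → (a * b) * sumTo R (⋆-term U V I j) I) I
      ≈⟨ *-sumTo (a * b) _ I ⟨
    (a * b) * (U ⋆ V) I ∎

  ⋆-scaleˡ : ∀ a U V I → ((λ j → a * U j) ⋆ V) I ≈ a * (U ⋆ V) I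
  ⋆-scaleˡ a U V I = trans (⋆-cong (λ _ _ → refl) (λ l _ → sym (*-identityˡ (V l))) I)
                           (trans (⋆-scale a 1# U V I) (*-congʳ (*-identityʳ a)))

  ⋆-scaleʳ : ∀ b U V I → (U ⋆ (λ l → b * V l)) I ≈ b * (U ⋆ V) I
  ⋆-scaleʳ b U V I = trans (⋆-cong (λ j _ → sym (*-identityˡ (U j))) (λ _ _ → refl) I)
                           (trans (⋆-scale 1# b U V I) (*-congʳ (*-identityˡ b)))

  -- With Q = 0# this is the ordinary degree.
  IsDegreeMod : Carrier → (ℕ → Carrier) → ℕ → Set (c ⊔ ℓ)
  IsDegreeMod Q U = LastFailure (λ i → Q ∣ U i)

  private
    beyond-degree : ∀ {Q a b j l} → IsDegreeMod Q U a → IsDegreeMod Q V b → a < j ⊎ b < l → Q ∣ U j * V l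
    beyond-degree {V = V} (_ , _ , Q∣U>) _ (inj₁ a<j) = ∣-*ʳ (V _) (Q∣U> _ a<j)
    beyond-degree {U = U} _ (_ , _ , Q∣V>) (inj₂ b<l) = ∣-*ˡ (U _) (Q∣V> _ b<l)

  degreeMod-⋆-leading : ∀ {a b : ℕ} → IsDegreeMod Q U a → IsDegreeMod Q V b →
                        (U ⋆ V) (a Nat.* b) ≈ U a * V b mod Q
  degreeMod-⋆-leading degU@(1≤a , _) degV@(1≤b , _) = ⋆-single 1≤a 1≤b ≡.refl λ j l _ 1≤l jl≡ab j≢a →
    beyond-degree degU degV (larger-factor-of-≡ 1≤l jl≡ab j≢a)

  degreeMod-⋆ : ∀ {a b : ℕ} → (∀ {x y} → ¬ Q ∣ x → ¬ Q ∣ y → ¬ Q ∣ x * y) →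
                IsDegreeMod Q U a → IsDegreeMod Q V b → IsDegreeMod Q (U ⋆ V) (a Nat.* b)
  degreeMod-⋆ {Q} {U} {V} {a} {b} ∤-* degU@(1≤a , Q∤Ua , _) degV@(1≤b , Q∤Vb , _) =
    ℕₚ.*-mono-≤ 1≤a 1≤b ,
    (λ Q∣UV → ∤-* Q∤Ua Q∤Vb (≈mod-∣ (degreeMod-⋆-leading degU degV) Q∣UV)) ,
    λ I ab<I → ⋆-∣ λ j l _ _ jl≡I →
      beyond-degree degU degV (larger-factor-of-< (≡.subst (a Nat.* b <_) (≡.sym jl≡I) ab<I))

  degreeMod-⋆-unique : ∀ {W : ℕ → Carrier} {a b e : ℕ} → (∀ I → 1 ≤ I → W I ≈ (U ⋆ V) I) →
                       (∀ {x y} → ¬ Q ∣ x → ¬ Q ∣ y → ¬ Q ∣ x * y) →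
                       IsDegreeMod Q U a → IsDegreeMod Q V b → IsDegreeMod Q W e → a Nat.* b ≡ e
  degreeMod-⋆-unique W≈UV ∤-* degU degV degW = lastFailure-unique
    (λ 1≤I Q∤UV Q∣W → Q∤UV (∣-respʳ (W≈UV _ 1≤I) Q∣W))
    (λ 1≤I Q∤W Q∣UV → Q∤W (∣-respʳ (sym (W≈UV _ 1≤I)) Q∣UV))
    (degreeMod-⋆ ∤-* degU degV) degW

  degree-leading-≉0 : ∀ {W d} → IsDegreeMod 0# W d → W d ≉ 0#
  degree-leading-≉0 (_ , 0∤Wd , _) Wd≈0 = 0∤Wd (≈0⇒0∣ Wd≈0)

  degree⇒nonzero : ∀ {W d} → IsDegreeMod 0# W d → ¬ (∀ j → 1 ≤ j → W j ≈ 0#)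
  degree⇒nonzero deg@(1≤d , _) all-zero = degree-leading-≉0 deg (all-zero _ 1≤d)

  nonconstant⇒nonzero : ∀ {W : DirPoly R} → ¬ IsConstant R W → ¬ (∀ i → 1 ≤ i → 0# ∣ coeff W i)
  nonconstant⇒nonzero nonconstant 0∣W = nonconstant λ i 2≤i → 0∣⇒≈0 (0∣W i (≤-trans (s≤s z≤n) 2≤i))

  nonconstant⇒2≤degree : ∀ {W : DirPoly R} {d} → ¬ IsConstant R W → IsDegreeMod 0# (coeff W) d → 2 ≤ d
  nonconstant⇒2≤degree {d = d} nonconstant (_ , _ , 0∣W>) with 2 ≤? d
  ... | yes 2≤d = 2≤d
  ... | no  2≰d = ⊥-elim (nonconstant λ i 2≤i → 0∣⇒≈0 (0∣W> i (<-≤-trans (≰⇒> 2≰d) 2≤i)))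

  degreeMod-exists : ∀ Q (U : DirPoly R) → ¬ (∀ i → 1 ≤ i → Q ∣ coeff U i) → ¬ ¬ ∃ (IsDegreeMod Q (coeff U))
  degreeMod-exists Q U = lastFailure (λ i → Q ∣ coeff U i) (proj₁ (support U))
                           λ i N<i → ∣-respʳ (sym (proj₂ (support U) i N<i)) ∣0

  irreducible-cong : ∀ {W W′} → (∀ i → W i ≈ W′ i) →
                     IrreducibleOver R R (λ x → x) W → IrreducibleOver R R (λ x → x) W′
  irreducible-cong W≈W′ irreducible (U , V , ncU , ncV , W′≈UV) =
    irreducible (U , V , ncU , ncV , λ I 1≤I → trans (W≈W′ I) (W′≈UV I 1≤I))

  scale : Carrier → DirPoly R → DirPoly R
  scale a f = record
    { coeff   = λ i → a * coeff f i
    ; support = proj₁ (support f) , λ i N<i → trans (*-congˡ (proj₂ (support f) i N<i)) (zeroʳ a)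
    }

  *-addScaled : ∀ {a b c} → c ≈ a * b → ∀ f P g i →
                c * addScaled R f P g i ≈ a * addScaled R (scale b f) P (scale b g) i
  *-addScaled {a} {b} {c} c≈ab f P g i = begin
    c * (coeff f i + P * coeff g i)                ≈⟨ *-congʳ c≈ab ⟩
    a * b * (coeff f i + P * coeff g i)            ≈⟨ *-assoc a b _ ⟩
    a * (b * (coeff f i + P * coeff g i))          ≈⟨ *-congˡ (distribˡ b _ _) ⟩
    a * (b * coeff f i + b * (P * coeff g i))      ≈⟨ *-congˡ (+-congˡ (x∙yz≈y∙xz b P (coeff g i))) ⟩
    a * (b * coeff f i + P * (b * coeff g i))      ∎

module DomainLemmas {c ℓ} (R : CommutativeRing c ℓ) (domain : IsIntegralDomain R) where
  open CommutativeRing R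
  open RingLemmas R
  open RingProperties ring using (x[y-z]≈xy-xz)
  open import Algebra.Properties.Group +-group using (x∙y⁻¹≈ε⇒x≈y)

  private variable
    a b x y : Carrier

  1≉0 : 1# ≉ 0#
  1≉0 = proj₁ domain

  *-≉0 : a ≉ 0# → b ≉ 0# → a * b ≉ 0#
  *-≉0 {a} {b} a≉0 b≉0 ab≈0 with proj₂ domain a b ab≈0
  ... | inj₁ a≈0 = a≉0 a≈0
  ... | inj₂ b≈0 = b≉0 b≈0

  pow-≉0 : ∀ e → a ≉ 0# → pow R a e ≉ 0#
  pow-≉0 zero    _   = 1≉0
  pow-≉0 (suc e) a≉0 = *-≉0 a≉0 (pow-≉0 e a≉0)

  *-cancelˡ : a ≉ 0# → a * x ≈ a * y → x ≈ y
  *-cancelˡ {a} {x} {y} a≉0 ax≈ay with proj₂ domain a (x - y) a[x-y]≈0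
    where
    a[x-y]≈0 : a * (x - y) ≈ 0#
    a[x-y]≈0 = trans (x[y-z]≈xy-xz a x y) (trans (+-congʳ ax≈ay) (-‿inverseʳ (a * y)))
  ... | inj₁ a≈0   = ⊥-elim (a≉0 a≈0)
  ... | inj₂ x-y≈0 = x∙y⁻¹≈ε⇒x≈y x y x-y≈0

  0∤-* : ¬ 0# ∣ x → ¬ 0# ∣ y → ¬ 0# ∣ x * y
  0∤-* 0∤x 0∤y 0∣xy = *-≉0 (0∤x ∘ ≈0⇒0∣) (0∤y ∘ ≈0⇒0∣) (0∣⇒≈0 0∣xy)

  scale-degree : ∀ {f m} → a ≉ 0# → HasDegree R f m → HasDegree R (scale a f) m
  scale-degree a≉0 (1≤m , fm≉0 , f>≈0) = 1≤m , *-≉0 a≉0 fm≉0 , λ i m<i → trans (*-congˡ (f>≈0 i m<i)) (zeroʳ _)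

  *-cancelˡ-∣ : a ≉ 0# → a * b ∣ a * x → b ∣ x
  *-cancelˡ-∣ {a} {b} a≉0 (w , ax≈abw) = w , *-cancelˡ a≉0 (trans ax≈abw (*-assoc a b w))

module PrimeLemmas {c ℓ} (R : CommutativeRing c ℓ) (domain : IsIntegralDomain R)
                   (p : CommutativeRing.Carrier R) (p-prime : IsPrimeElt R p) where
  open CommutativeRing R
  open RingLemmas R
  open DomainLemmas R domain
  open CommutativeSemigroupProperties *-commutativeSemigroup using (interchange; x∙yz≈y∙xz)
  open import Relation.Binary.Reasoning.Setoid setoid

  private variable
    x y : Carrier
    e f : ℕ

  p≉0 : p ≉ 0#
  p≉0 = proj₁ p-prime

  ∤-* : ¬ p ∣ x → ¬ p ∣ y → ¬ p ∣ x * y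
  ∤-* {x} {y} p∤x p∤y p∣xy with proj₂ (proj₂ p-prime) x y p∣xy
  ... | inj₁ p∣x = p∤x p∣x
  ... | inj₂ p∣y = p∤y p∣y

  ∤⇒≉0 : ¬ p ∣ x → x ≉ 0#
  ∤⇒≉0 p∤x x≈0 = p∤x (∣-respʳ (sym x≈0) ∣0)

  record HasValuation (x : Carrier) (e : ℕ) : Set (c ⊔ ℓ) where
    constructor exactly
    field
      cofactor      : Carrier
      factorisation : x ≈ pow R p e * cofactor
      cofactor-∤    : ¬ p ∣ cofactor

  valuation-resp : x ≈ y → HasValuation x e → HasValuation y e
  valuation-resp x≈y (exactly z x≈pz p∤z) = exactly z (trans (sym x≈y) x≈pz) p∤z

  ∤⇒valuation-0 : ¬ p ∣ x → HasValuation x 0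
  ∤⇒valuation-0 {x} p∤x = exactly x (sym (*-identityˡ x)) p∤x

  valuation-≉0 : HasValuation x e → x ≉ 0#
  valuation-≉0 {e = e} (exactly y x≈pᵉy p∤y) x≈0 = *-≉0 (pow-≉0 e p≉0) (∤⇒≉0 p∤y) (trans (sym x≈pᵉy) x≈0)

  valuation-∣ : HasValuation x e → f ≤ e → pow R p f ∣ x
  valuation-∣ (exactly y x≈pᵉy _) f≤e = ∣-respʳ (sym x≈pᵉy) (∣-*ʳ _ (pow-∣ p f≤e))

  valuation-∤ : HasValuation x e → ¬ pow R p (suc e) ∣ x
  valuation-∤ {x} {e} (exactly y x≈pᵉy p∤y) pᵉ⁺¹∣x =
    p∤y (*-cancelˡ-∣ (pow-≉0 e p≉0) (∣-respˡ (*-comm p _) (∣-respʳ x≈pᵉy pᵉ⁺¹∣x)))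

  pow∣⇒≤valuation : HasValuation x e → pow R p f ∣ x → f ≤ e
  pow∣⇒≤valuation {e = e} {f} val pᶠ∣x with f ≤? e
  ... | yes f≤e = f≤e
  ... | no  f≰e = ⊥-elim (valuation-∤ val (∣-trans (pow-∣ p (≰⇒> f≰e)) pᶠ∣x))

  valuation-0⇒∤ : HasValuation x 0 → ¬ p ∣ x
  valuation-0⇒∤ val p∣x = valuation-∤ val (∣-respˡ (sym (*-identityʳ p)) p∣x)

  degreeMod-p≡degree : ∀ {U d a} → IsDegreeMod 0# U d → IsDegreeMod p U a → ¬ p ∣ U d → a ≡ d
  degreeMod-p≡degree deg@(_ , 0∤Ud , _) pdeg@(_ , p∤Ua , _) p∤Ud =
    ℕₚ.≤-antisym (lastFailure-≤ deg λ 0∣Ua → p∤Ua (∣-respʳ (sym (0∣⇒≈0 0∣Ua)) ∣0)) (lastFailure-≤ pdeg p∤Ud)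

  valuation-unique : HasValuation x e → HasValuation x f → e ≡ f
  valuation-unique val val′ =
    ℕₚ.≤-antisym (pow∣⇒≤valuation val′ (valuation-∣ val ≤-refl))
                 (pow∣⇒≤valuation val (valuation-∣ val′ ≤-refl))

  valuation-* : HasValuation x e → HasValuation y f → HasValuation (x * y) (e Nat.+ f)
  valuation-* {x} {e} {y} {f} (exactly x′ x≈pᵉx′ p∤x′) (exactly y′ y≈pᶠy′ p∤y′) = exactly (x′ * y′) (begin
    x * y                            ≈⟨ *-cong x≈pᵉx′ y≈pᶠy′ ⟩
    pow R p e * x′ * (pow R p f * y′) ≈⟨ interchange _ _ _ _ ⟩
    pow R p e * pow R p f * (x′ * y′) ≈⟨ *-congʳ (pow-+ p e f) ⟨
    pow R p (e Nat.+ f) * (x′ * y′)   ∎) (∤-* p∤x′ p∤y′)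

  prime⇒irreducible : IsIrreducibleElt R p
  prime⇒irreducible = p≉0 , proj₁ (proj₂ p-prime) , factors
    where
    unit-cofactor : ∀ {x y z} → p ≈ x * y → x ≈ p * z → IsUnit R y
    unit-cofactor {x} {y} {z} p≈xy x≈pz = z , *-cancelˡ p≉0 (begin
      p * (y * z) ≈⟨ x∙yz≈y∙xz p y z ⟩
      y * (p * z) ≈⟨ *-comm y _ ⟩
      p * z * y   ≈⟨ *-congʳ x≈pz ⟨
      x * y       ≈⟨ p≈xy ⟨
      p           ≈⟨ *-identityʳ p ⟨
      p * 1#      ∎)
    factors : ∀ x y → p ≈ x * y → IsUnit R x ⊎ IsUnit R y
    factors x y p≈xy with proj₂ (proj₂ p-prime) x y (1# , trans (sym p≈xy) (sym (*-identityʳ p)))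
    ... | inj₁ (z , x≈pz) = inj₂ (unit-cofactor p≈xy x≈pz)
    ... | inj₂ (z , y≈pz) = inj₁ (unit-cofactor (trans p≈xy (*-comm x y)) y≈pz)

  p*-not-unit : ∀ w → ¬ IsUnit R (p * w)
  p*-not-unit w (u , pwu≈1) = proj₁ (proj₂ p-prime) (w * u , trans (sym (*-assoc p w u)) pwu≈1)

  -- If x = p^e w, the factorisation of p x into irreducibles has as many factors as p^e times one of
  -- p w, so at least e of them (p x rather than x, which may be a unit).
  valuation-bounded : IsUFD R → x ≉ 0# → ∃ λ L → ∀ e → pow R p e ∣ x → e ≤ L
  valuation-bounded {x} (_ , factorise , unique) x≉0 = length xs , bound
    where
    factorise-p* : ∀ w → w ≉ 0# → ∃ λ xs → All (IsIrreducibleElt R) xs × p * w ≈ prodL R xs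
    factorise-p* w w≉0 = factorise (p * w) (*-≉0 p≉0 w≉0) (p*-not-unit w)
    xs = proj₁ (factorise-p* x x≉0)
    bound : ∀ e → pow R p e ∣ x → e ≤ length xs
    bound e (w , x≈pᵉw) = ≤-trans (≤-reflexive (≡.sym (Listₚ.length-replicate e)))
                           (≤-trans (Listₚ.length-++-≤ˡ (replicate e p)) (≤-reflexive same-length))
      where
      w≉0 : w ≉ 0#
      w≉0 w≈0 = x≉0 (trans x≈pᵉw (trans (*-congˡ w≈0) (zeroʳ _)))
      zs = proj₁ (factorise-p* w w≉0)
      pw≈zs = proj₂ (proj₂ (factorise-p* w w≉0))
      same-product : prodL R (replicate e p ++ zs) ≈ prodL R xs
      same-product = begin
        prodL R (replicate e p ++ zs)        ≈⟨ prodL-++ (replicate e p) zs ⟩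
        prodL R (replicate e p) * prodL R zs ≈⟨ *-cong (sym (prodL-replicate e p)) pw≈zs ⟨
        pow R p e * (p * w)                  ≈⟨ x∙yz≈y∙xz (pow R p e) p w ⟩
        p * (pow R p e * w)                  ≈⟨ *-congˡ x≈pᵉw ⟨
        p * x                                ≈⟨ proj₂ (proj₂ (factorise-p* x x≉0)) ⟩
        prodL R xs                           ∎
      same-length : length (replicate e p ++ zs) ≡ length xs
      same-length = FinPermutation.↔⇒≡ (Permutation.onIndices
        (unique _ xs (++⁺ (replicate⁺ e prime⇒irreducible) (proj₁ (proj₂ (factorise-p* w w≉0))))
                     (proj₁ (proj₂ (factorise-p* x x≉0))) same-product))

  ¬¬-valuation-below : ∀ L x → (∀ e → pow R p e ∣ x → e ≤ L) → ¬ ¬ ∃ (HasValuation x)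
  ¬¬-valuation-below L x bounded k = do
    yes (x′ , x≈px′) ← ¬¬-excluded-middle {A = p ∣ x}
      where no p∤x → k (0 , ∤⇒valuation-0 p∤x)
    divide-by-p L x′ x≈px′ bounded
    where
    p*-valuation : ∀ {x x′ e} → x ≈ p * x′ → HasValuation x′ e → HasValuation x (suc e)
    p*-valuation {e = e} x≈px′ (exactly y x′≈pᵉy p∤y) =
      exactly y (trans x≈px′ (trans (*-congˡ x′≈pᵉy) (sym (*-assoc p (pow R p e) y)))) p∤y
    divide-by-p : ∀ L x′ → x ≈ p * x′ → (∀ e → pow R p e ∣ x → e ≤ L) → ⊥
    divide-by-p zero     x′ x≈px′ bounded =
      <⇒≱ ≤-refl (bounded 1 (x′ , trans x≈px′ (*-congʳ (sym (*-identityʳ p)))))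
    divide-by-p (suc L′) x′ x≈px′ bounded =
      ¬¬-valuation-below L′ x′ bounded′ λ (e , val) → k (suc e , p*-valuation x≈px′ val)
      where
      bounded′ : ∀ e → pow R p e ∣ x′ → e ≤ L′
      bounded′ e (w , x′≈pᵉw) =
        ≤-pred (bounded (suc e) (w , trans x≈px′ (trans (*-congˡ x′≈pᵉw) (sym (*-assoc p _ w)))))

  ¬¬-valuation : IsUFD R → x ≉ 0# → ¬ ¬ ∃ (HasValuation x)
  ¬¬-valuation {x} ufd x≉0 = ¬¬-valuation-below (proj₁ bound) x (proj₂ bound)
    where bound = valuation-bounded ufd x≉0

  p∣-factor : (U V : DirPoly R) → (∀ I → 1 ≤ I → p ∣ (coeff U ⋆ coeff V) I) →
              ¬ ¬ ((∀ j → 1 ≤ j → p ∣ coeff U j) ⊎ (∀ j → 1 ≤ j → p ∣ coeff V j))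
  p∣-factor U V p∣UV k = do
    no p∤U ← ¬¬-excluded-middle
      where yes p∣U → k (inj₁ p∣U)
    no p∤V ← ¬¬-excluded-middle
      where yes p∣V → k (inj₂ p∣V)
    (a , degU) ← degreeMod-exists p U p∤U
    (b , degV) ← degreeMod-exists p V p∤V
    let (1≤ab , p∤UVab , _) = degreeMod-⋆ ∤-* degU degV
    p∤UVab (p∣UV (a Nat.* b) 1≤ab)

  divide : (U : DirPoly R) → (∀ j → 1 ≤ j → p ∣ coeff U j) → DirPoly R
  divide U p∣U = record { coeff = quotient ; support = proj₁ (support U) , vanishes }
    where
    quotient : ℕ → Carrier
    quotient zero    = 0#
    quotient (suc j) = proj₁ (p∣U (suc j) (s≤s z≤n))
    vanishes : ∀ i → proj₁ (support U) < i → quotient i ≈ 0#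
    vanishes (suc i) N<i = *-cancelˡ p≉0 (trans (sym (proj₂ (p∣U (suc i) (s≤s z≤n))))
                                           (trans (proj₂ (support U) (suc i) N<i) (sym (zeroʳ p))))

  divide-spec : ∀ U p∣U j → 1 ≤ j → coeff U j ≈ p * coeff (divide U p∣U) j
  divide-spec U p∣U (suc j) _ = proj₂ (p∣U (suc j) (s≤s z≤n))

  divide-nonconstant : ∀ U p∣U → ¬ IsConstant R U → ¬ IsConstant R (divide U p∣U)
  divide-nonconstant U p∣U nonconstant constant = nonconstant λ i 2≤i →
    trans (divide-spec U p∣U i (≤-trans (s≤s z≤n) 2≤i)) (trans (*-congˡ (constant i 2≤i)) (zeroʳ p))

  irreducible-p* : ∀ W → IrreducibleOver R R (λ x → x) W →
                   IrreducibleOver R R (λ x → x) (λ i → p * W i)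
  irreducible-p* W irreducible (U , V , ncU , ncV , pW≈UV) = do
    inj₁ p∣U ← p∣-factor U V λ I 1≤I → ∣-respʳ (pW≈UV I 1≤I) (∣-*ʳ (W I) ∣-refl)
      where inj₂ p∣V → irreducible (U , divide V p∣V , ncU , divide-nonconstant V p∣V ncV , λ I 1≤I →
              *-cancelˡ p≉0 (trans (pW≈UV I 1≤I) (trans (⋆-cong (λ _ _ → refl) (divide-spec V p∣V) I)
                                                        (⋆-scaleʳ p (coeff U) _ I))))
    irreducible (divide U p∣U , V , divide-nonconstant U p∣U ncU , ncV , λ I 1≤I →
      *-cancelˡ p≉0 (trans (pW≈UV I 1≤I) (trans (⋆-cong (divide-spec U p∣U) (λ _ _ → refl) I)
                                                (⋆-scaleˡ p _ (coeff V) I))))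

  irreducible-pow* : ∀ s W → IrreducibleOver R R (λ x → x) W →
                     IrreducibleOver R R (λ x → x) (λ i → pow R p s * W i)
  irreducible-pow* zero    W irreducible = irreducible-cong (λ i → sym (*-identityˡ (W i))) irreducible
  irreducible-pow* (suc s) W irreducible = irreducible-cong (λ i → sym (*-assoc p (pow R p s) (W i)))
                                             (irreducible-p* _ (irreducible-pow* s W irreducible))

  Valuations : (ℕ → Carrier) → Set (c ⊔ ℓ)
  Valuations U = ∀ j → U j ≈ 0# ⊎ ∃ (HasValuation (U j))

  valuations : IsUFD R → (U : DirPoly R) → ¬ ¬ Valuations (coeff U)
  valuations ufd U = ¬¬-∀-cofinite (proj₁ (support U)) (λ j N<j → inj₁ (proj₂ (support U) j N<j)) λ j k → do
    no Uj≉0 ← ¬¬-excluded-middle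
      where yes Uj≈0 → k (inj₁ Uj≈0)
    val ← ¬¬-valuation ufd Uj≉0
    k (inj₂ val)

  valuation-of : ∀ {U} → Valuations U → ∀ j → U j ≉ 0# → ∃ (HasValuation (U j))
  valuation-of valU j Uj≉0 with valU j
  ... | inj₁ Uj≈0 = ⊥-elim (Uj≉0 Uj≈0)
  ... | inj₂ val  = val

module NewtonPolygon {c ℓ} (R : CommutativeRing c ℓ) (domain : IsIntegralDomain R)
                     (p : CommutativeRing.Carrier R) (p-prime : IsPrimeElt R p)
                     (m n k : ℕ) (1≤m : 1 ≤ m) (m≤n : m ≤ n) where
  open CommutativeRing R
  open RingLemmas R
  open DomainLemmas R domain
  open PrimeLemmas R domain p p-prime
  open Weight m n k

  index : ℕ × ℕ → ℕ
  index = proj₁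

  IsTerm : (ℕ → Carrier) → ℕ × ℕ → Set (c ⊔ ℓ)
  IsTerm U (j , e) = 1 ≤ j × HasValuation (U j) e

  -- Ties are broken towards the larger index, so that the product of the minimal terms of two
  -- factors is the only product of terms of least weight with its index.
  infix 4 _≼_
  _≼_ : ℕ × ℕ → ℕ × ℕ → Set
  A ≼ B = weight A ≤ᶠ weight B × (index A < index B → weight A <ᶠ weight B)

  IsMinimalTerm : (ℕ → Carrier) → ℕ × ℕ → Set (c ⊔ ℓ)
  IsMinimalTerm U A = IsTerm U A × ∀ {B} → IsTerm U B → A ≼ B

  private
    1≤n = ≤-trans 1≤m m≤n

    positive-weight : ∀ A → 1 ≤ index A → Positive (weight A)
    positive-weight (j , e) 1≤j = weight-positive 1≤m 1≤n e 1≤j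

    ≼-refl : ∀ A → A ≼ A
    ≼-refl A = ≤ᶠ-refl , λ i<i → ⊥-elim (ℕₚ.<-irrefl ≡.refl i<i)

    ≤-suc-cases : ∀ {j N} → j ≤ suc N → j ≡ suc N ⊎ j ≤ N
    ≤-suc-cases j≤N+1 with ℕₚ.m≤n⇒m<n∨m≡n j≤N+1
    ... | inj₁ j<N+1 = inj₂ (ℕₚ.m<1+n⇒m≤n j<N+1)
    ... | inj₂ j≡N+1 = inj₁ j≡N+1

  MinimalUpTo : (ℕ → Carrier) → ℕ → ℕ × ℕ → Set (c ⊔ ℓ)
  MinimalUpTo U N A = IsTerm U A × ∀ {B} → IsTerm U B → index B ≤ N → A ≼ B

  minimalTerm-upTo : ∀ U → Valuations U → ∀ N → (∀ j → 1 ≤ j → j ≤ N → U j ≈ 0#) ⊎ ∃ (MinimalUpTo U N)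
  minimalTerm-upTo U valuations zero = inj₁ λ j 1≤j j≤0 → ⊥-elim (<⇒≱ 1≤j j≤0)
  minimalTerm-upTo U valuations (suc N) with minimalTerm-upTo U valuations N | valuations (suc N)
  ... | inj₁ zero≤N | inj₁ zeroN+1 = inj₁ λ j 1≤j j≤N+1 → case 1≤j (≤-suc-cases j≤N+1)
    where
    case : ∀ {j} → 1 ≤ j → j ≡ suc N ⊎ j ≤ N → U j ≈ 0#
    case _   (inj₁ ≡.refl) = zeroN+1
    case 1≤j (inj₂ j≤N)    = zero≤N _ 1≤j j≤N
  ... | inj₂ (A , termA , minA) | inj₁ zeroN+1 =
    inj₂ (A , termA , λ termB B≤N+1 → case termB (≤-suc-cases B≤N+1))
    where
    case : ∀ {j f} → IsTerm U (j , f) → j ≡ suc N ⊎ j ≤ N → A ≼ (j , f)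
    case (_ , valB) (inj₁ ≡.refl) = ⊥-elim (valuation-≉0 valB zeroN+1)
    case termB      (inj₂ j≤N)    = minA termB j≤N
  ... | inj₁ zero≤N | inj₂ (e , val) =
    inj₂ ((suc N , e) , (s≤s z≤n , val) , λ termB B≤N+1 → case termB (≤-suc-cases B≤N+1))
    where
    case : ∀ {j f} → IsTerm U (j , f) → j ≡ suc N ⊎ j ≤ N → (suc N , e) ≼ (j , f)
    case (_   , valB) (inj₁ ≡.refl) rewrite valuation-unique valB val = ≼-refl (suc N , e)
    case (1≤j , valB) (inj₂ j≤N)    = ⊥-elim (valuation-≉0 valB (zero≤N _ 1≤j j≤N))
  ... | inj₂ (A , termA , minA) | inj₂ (e , val) with ≤ᶠ-total (weight (suc N , e)) (weight A)
  ...   | inj₁ new≤A =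
    inj₂ ((suc N , e) , (s≤s z≤n , val) , λ termB B≤N+1 → case termB (≤-suc-cases B≤N+1))
    where
    case : ∀ {j f} → IsTerm U (j , f) → j ≡ suc N ⊎ j ≤ N → (suc N , e) ≼ (j , f)
    case (_ , valB) (inj₁ ≡.refl) rewrite valuation-unique valB val = ≼-refl (suc N , e)
    case termB (inj₂ j≤N) =
      ≤ᶠ-trans {y = weight A} (positive-weight A (proj₁ termA)) new≤A (proj₁ (minA termB j≤N)) ,
      λ N<j → ⊥-elim (<⇒≱ N<j (m≤n⇒m≤1+n j≤N))
  ...   | inj₂ A<new =
    inj₂ (A , termA , λ termB B≤N+1 → case termB (≤-suc-cases B≤N+1))
    where
    case : ∀ {j f} → IsTerm U (j , f) → j ≡ suc N ⊎ j ≤ N → A ≼ (j , f)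
    case (_ , valB) (inj₁ ≡.refl) rewrite valuation-unique valB val = <ᶠ⇒≤ᶠ A<new , λ _ → A<new
    case termB (inj₂ j≤N) = minA termB j≤N

  minimalTerm : (U : DirPoly R) → Valuations (coeff U) → ¬ (∀ j → 1 ≤ j → coeff U j ≈ 0#) →
                ∃ (IsMinimalTerm (coeff U))
  minimalTerm U valuations nonzero with minimalTerm-upTo (coeff U) valuations N
    where N = proj₁ (support U)
  ... | inj₁ zero≤N = ⊥-elim (nonzero λ j 1≤j → case 1≤j (j ≤? proj₁ (support U)))
    where
    case : ∀ {j} → 1 ≤ j → Dec (j ≤ proj₁ (support U)) → coeff U j ≈ 0#
    case 1≤j (yes j≤N) = zero≤N _ 1≤j j≤N
    case 1≤j (no  j≰N) = proj₂ (support U) _ (≰⇒> j≰N)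
  ... | inj₂ (A , termA , minA) = A , termA , λ termB → minA termB (within-support termB)
    where
    within-support : ∀ {j f} → IsTerm (coeff U) (j , f) → j ≤ proj₁ (support U)
    within-support {j} (_ , valB) with j ≤? proj₁ (support U)
    ... | yes j≤N = j≤N
    ... | no  j≰N = ⊥-elim (valuation-≉0 valB (proj₂ (support U) j (≰⇒> j≰N)))

  -- Every other product of terms with the same index has larger weight, hence larger valuation.
  ⋆-valuation-at-minimal : ∀ U V → Valuations U → Valuations V → ∀ {i e j f} →
                           IsMinimalTerm U (i , e) → IsMinimalTerm V (j , f) →
                           ¬ pow R p (suc (e Nat.+ f)) ∣ (U ⋆ V) (i Nat.* j)
  ⋆-valuation-at-minimal U V valU valV {i} {e} {j} {f} ((1≤i , valUi) , minU) ((1≤j , valVj) , minV) Q∣UV =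
    valuation-∤ (valuation-* valUi valVj) (≈mod-∣ (⋆-single 1≤i 1≤j ≡.refl others) Q∣UV)
    where
    Q = pow R p (suc (e Nat.+ f))
    others : ∀ i′ j′ → 1 ≤ i′ → 1 ≤ j′ → i′ Nat.* j′ ≡ i Nat.* j → i′ ≢ i → Q ∣ U i′ * V j′
    others i′ j′ 1≤i′ 1≤j′ i′j′≡ij i′≢i with valU i′ | valV j′
    ... | inj₁ Ui′≈0 | _ = ∣-respʳ (sym (trans (*-congʳ Ui′≈0) (zeroˡ _))) ∣0
    ... | inj₂ _ | inj₁ Vj′≈0 = ∣-respʳ (sym (trans (*-congˡ Vj′≈0) (zeroʳ _))) ∣0
    ... | inj₂ (e′ , valUi′) | inj₂ (f′ , valVj′) =
      valuation-∣ (valuation-* valUi′ valVj′) (weight-exponent-< m≤n {i Nat.* j} {e Nat.+ f} heavier)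
      where
      termU = 1≤i′ , valUi′
      termV = 1≤j′ , valVj′
      products : weight (i , e) ⊗ weight (j , f) <ᶠ weight (i′ , e′) ⊗ weight (j′ , f′)
      products with larger-factor-of-≡ 1≤j′ i′j′≡ij i′≢i
      ... | inj₁ i<i′ = ⊗-mono-<ᶠ-≤ᶠ (positive-weight (j , f) 1≤j) (positive-weight (j′ , f′) 1≤j′)
                                     (proj₂ (minU termU) i<i′) (proj₁ (minV termV))
      ... | inj₂ j<j′ = ⊗-mono-≤ᶠ-<ᶠ (positive-weight (i , e) 1≤i) (positive-weight (i′ , e′) 1≤i′)
                                     (proj₁ (minU termU)) (proj₂ (minV termV) j<j′)
      heavier : weight (i Nat.* j , e Nat.+ f) <ᶠ weight (i Nat.* j , e′ Nat.+ f′)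
      heavier = ≡.subst₂ _<ᶠ_ (≡.sym (weight-* i j e f))
        (≡.trans (≡.sym (weight-* i′ j′ e′ f′)) (≡.cong (λ t → weight (t , e′ Nat.+ f′)) i′j′≡ij)) products

module OverRing {c ℓ} (R : CommutativeRing c ℓ) (ufd : IsUFD R)
                (p : CommutativeRing.Carrier R) (p-prime : IsPrimeElt R p)
                (f g : DirPoly R) {m n : ℕ} (deg-f : HasDegree R f m) (deg-g : HasDegree R g n)
                (coprime : Coprime m n) (m<n : m < n)
                (p∤fm : ¬ Divides R p (coeff f m)) (p∤gn : ¬ Divides R p (coeff g n))
                {k : ℕ} (1≤k : 1 ≤ k) (condition : ExponentCondition m n k) where
  open CommutativeRing R
  open RingLemmas R
  open DomainLemmas R (proj₁ ufd)
  open PrimeLemmas R (proj₁ ufd) p p-prime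
  open Weight m n k
  open NewtonPolygon R (proj₁ ufd) p p-prime m n k (proj₁ deg-f) (<⇒≤ m<n)

  h : ℕ → Carrier
  h = addScaled R f (pow R p k) g

  private
    1≤m = proj₁ deg-f
    1≤n = ≤-trans 1≤m (<⇒≤ m<n)

  h-above-m : ∀ {i} → m < i → h i ≈ pow R p k * coeff g i
  h-above-m m<i = trans (+-congʳ (proj₂ (proj₂ deg-f) _ m<i)) (+-identityˡ _)

  h-above-n : ∀ {i} → n < i → h i ≈ 0#
  h-above-n n<i = trans (h-above-m (ℕₚ.<-trans m<n n<i)) (trans (*-congˡ (proj₂ (proj₂ deg-g) _ n<i)) (zeroʳ _))

  p∣pᵏ : p ∣ pow R p k
  p∣pᵏ = ∣-respˡ (*-identityʳ p) (pow-∣ p 1≤k)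

  h-valuation-n : HasValuation (h n) k
  h-valuation-n = exactly (coeff g n) (h-above-m m<n) p∤gn

  h-degree : IsDegreeMod 0# h n
  h-degree = 1≤n , (λ 0∣hn → valuation-≉0 h-valuation-n (0∣⇒≈0 0∣hn)) , λ i n<i → ≈0⇒0∣ (h-above-n n<i)

  h-degree-mod-p : IsDegreeMod p h m
  h-degree-mod-p = 1≤m , (λ p∣hm → p∤fm (≈mod-∣ (+-≈mod (∣-*ʳ (coeff g m) p∣pᵏ)) p∣hm)) ,
                   λ i m<i → ∣-respʳ (sym (h-above-m m<i)) (∣-*ʳ (coeff g i) p∣pᵏ)

  h-above-segment : ∀ {I v} → 1 ≤ I → ¬ pow R p (suc v) ∣ h I → weight (m , 0) ≤ᶠ weight (I , v)
  h-above-segment {I} {v} 1≤I pᵛ⁺¹∤hI with n <? I | m <? I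
  ... | yes n<I | _       = ⊥-elim (pᵛ⁺¹∤hI (∣-respʳ (sym (h-above-n n<I)) ∣0))
  ... | no  _   | no  m≮I = weight-antitone (<⇒≤ m<n) {f = v} (≮⇒≥ m≮I) z≤n
  ... | no  n≮I | yes m<I = ≤ᶠ-trans {y = weight (n , k)} (weight-positive 1≤m 1≤n k 1≤n) weight-m,0≤n,k
                              (weight-antitone (<⇒≤ m<n) {e = k} {f = v} (≮⇒≥ n≮I) k≤v)
    where
    k≤v : k ≤ v
    k≤v with k ≤? v
    ... | yes k≤v = k≤v
    ... | no  k≰v =
      ⊥-elim (pᵛ⁺¹∤hI (∣-trans (pow-∣ p (≰⇒> k≰v)) (∣-respʳ (sym (h-above-m m<I)) (∣-*ʳ _ ∣-refl))))

  exponent-positive : ∀ {W : DirPoly R} {d a e} → ¬ IsConstant R W →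
                      IsDegreeMod 0# (coeff W) d → IsDegreeMod p (coeff W) a → HasValuation (coeff W d) e →
                      (a ≡ d → d ℕ∣.∣ m × d ℕ∣.∣ n) → 1 ≤ e
  exponent-positive {e = suc _} _ _ _ _ _ = s≤s z≤n
  exponent-positive {W = W} {e = zero} nonconstant deg pdeg val common
    with common (degreeMod-p≡degree deg pdeg (valuation-0⇒∤ val))
  ... | d∣m , d∣n =
    ⊥-elim (<⇒≱ (nonconstant⇒2≤degree {W = W} nonconstant deg) (≤-reflexive (coprime (d∣m , d∣n))))

  module Factorisation (U V : DirPoly R) (ncU : ¬ IsConstant R U) (ncV : ¬ IsConstant R V)
                       (h≈UV : ∀ I → 1 ≤ I → h I ≈ (coeff U ⋆ coeff V) I)
                       (valU : Valuations (coeff U)) (valV : Valuations (coeff V))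
                       {d₁ d₂ a b : ℕ}
                       (degU : IsDegreeMod 0# (coeff U) d₁) (degV : IsDegreeMod 0# (coeff V) d₂)
                       (pdegU : IsDegreeMod p (coeff U) a) (pdegV : IsDegreeMod p (coeff V) b) where
    d₁d₂≡n : d₁ Nat.* d₂ ≡ n
    d₁d₂≡n = degreeMod-⋆-unique h≈UV 0∤-* degU degV h-degree

    ab≡m : a Nat.* b ≡ m
    ab≡m = degreeMod-⋆-unique h≈UV ∤-* pdegU pdegV h-degree-mod-p

    k₁ = proj₁ (valuation-of valU d₁ (degree-leading-≉0 degU))
    k₂ = proj₁ (valuation-of valV d₂ (degree-leading-≉0 degV))
    valUd₁ = proj₂ (valuation-of valU d₁ (degree-leading-≉0 degU))
    valVd₂ = proj₂ (valuation-of valV d₂ (degree-leading-≉0 degV))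

    k₁+k₂≡k : k₁ Nat.+ k₂ ≡ k
    k₁+k₂≡k = valuation-unique (valuation-* valUd₁ valVd₂) (valuation-resp hn≈UV h-valuation-n)
      where
      hn≈UV : h n ≈ coeff U d₁ * coeff V d₂
      hn≈UV = trans (h≈UV n 1≤n) (≡.subst (λ t → (coeff U ⋆ coeff V) t ≈ _) d₁d₂≡n
                                    (≈mod0⇒≈ (degreeMod-⋆-leading degU degV)))

    1≤k₁ : 1 ≤ k₁
    1≤k₁ = exponent-positive {W = U} ncU degU pdegU valUd₁ λ { ≡.refl →
      ℕ∣.divides b (≡.trans (≡.sym ab≡m) (ℕₚ.*-comm a b)) ,
      ℕ∣.divides d₂ (≡.trans (≡.sym d₁d₂≡n) (ℕₚ.*-comm d₁ d₂)) }

    1≤k₂ : 1 ≤ k₂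
    1≤k₂ = exponent-positive {W = V} ncV degV pdegV valVd₂ λ { ≡.refl →
      ℕ∣.divides a (≡.sym ab≡m) , ℕ∣.divides d₁ (≡.sym d₁d₂≡n) }

    k₁<k : k₁ < k
    k₁<k = ≡.subst (k₁ <_) k₁+k₂≡k (≡.subst (_≤ k₁ Nat.+ k₂) (ℕₚ.+-comm k₁ 1) (ℕₚ.+-monoʳ-≤ k₁ 1≤k₂))

    A = proj₁ (minimalTerm U valU (degree⇒nonzero degU))
    B = proj₁ (minimalTerm V valV (degree⇒nonzero degV))
    minA = proj₂ (minimalTerm U valU (degree⇒nonzero degU))
    minB = proj₂ (minimalTerm V valV (degree⇒nonzero degV))

    1≤iA : 1 ≤ index A
    1≤iA = proj₁ (proj₁ minA)
    1≤iB : 1 ≤ index B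
    1≤iB = proj₁ (proj₁ minB)

    above-segment : weight (m , 0) ≤ᶠ weight A ⊗ weight B
    above-segment = ≡.subst (weight (m , 0) ≤ᶠ_) (weight-* (index A) (index B) (proj₂ A) (proj₂ B))
      (h-above-segment {v = proj₂ A Nat.+ proj₂ B} 1≤I λ p∣h →
        ⋆-valuation-at-minimal (coeff U) (coeff V) valU valV minA minB (∣-respʳ (h≈UV _ 1≤I) p∣h))
      where 1≤I = ℕₚ.*-mono-≤ 1≤iA 1≤iB

    A≤a,0 : weight A ≤ᶠ weight (a , 0)
    A≤a,0 = proj₁ (proj₂ minA (proj₁ pdegU , ∤⇒valuation-0 (proj₁ (proj₂ pdegU))))
    B≤b,0 : weight B ≤ᶠ weight (b , 0)
    B≤b,0 = proj₁ (proj₂ minB (proj₁ pdegV , ∤⇒valuation-0 (proj₁ (proj₂ pdegV))))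
    A≤d₁,k₁ : weight A ≤ᶠ weight (d₁ , k₁)
    A≤d₁,k₁ = proj₁ (proj₂ minA (proj₁ degU , valUd₁))
    B≤d₂,k₂ : weight B ≤ᶠ weight (d₂ , k₂)
    B≤d₂,k₂ = proj₁ (proj₂ minB (proj₁ degV , valVd₂))

    positive : ∀ {i} e → 1 ≤ i → Positive (weight (i , e))
    positive = weight-positive 1≤m 1≤n

    a,0≤A : weight (a , 0) ≤ᶠ weight A
    a,0≤A = ⊗-tight (positive (proj₂ B) 1≤iB) (positive 0 (proj₁ pdegV)) A≤a,0 B≤b,0
      (≡.subst (_≤ᶠ weight A ⊗ weight B)
        (≡.trans (≡.cong (λ t → weight (t , 0)) (≡.sym ab≡m)) (weight-* a b 0 0))
        above-segment)

    d₁,k₁≤A : weight (d₁ , k₁) ≤ᶠ weight A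
    d₁,k₁≤A = ⊗-tight (positive (proj₂ B) 1≤iB) (positive k₂ (proj₁ degV)) A≤d₁,k₁ B≤d₂,k₂
      (≤ᶠ-trans {y = weight (m , 0)} (positive 0 1≤m)
        (≡.subst (_≤ᶠ weight (m , 0))
          (≡.trans (≡.cong₂ (λ s t → weight (s , t)) (≡.sym d₁d₂≡n) (≡.sym k₁+k₂≡k)) (weight-* d₁ d₂ k₁ k₂))
          weight-n,k≤m,0)
        above-segment)

    power-identity : m Nat.^ k₁ Nat.* d₁ Nat.^ k ≡ n Nat.^ k₁ Nat.* a Nat.^ k
    power-identity = weight-equal {a} {d₁} {k₁} (≤ᶠ-trans (positive (proj₂ A) 1≤iA) a,0≤A A≤d₁,k₁)
                                               (≤ᶠ-trans (positive (proj₂ A) 1≤iA) d₁,k₁≤A A≤a,0)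

    absurd : ⊥
    absurd = <⇒≱ k₁<k (ℕ∣.∣⇒≤ {{>-nonZero 1≤k₁}}
               (∣-from-power-identity condition 1≤k 1≤m 1≤n (proj₁ pdegU) (proj₁ degU) power-identity))

  irreducible : IrreducibleOver R R (λ x → x) h
  irreducible (U , V , ncU , ncV , h≈UV) = do
    valU ← valuations ufd U
    valV ← valuations ufd V
    d₁ , degU ← degreeMod-exists 0# U (nonconstant⇒nonzero {U} ncU)
    d₂ , degV ← degreeMod-exists 0# V (nonconstant⇒nonzero {V} ncV)
    a , pdegU ← degreeMod-exists p U λ p∣U → p∤hm (⋆-∣ {I = m} λ j l 1≤j _ _ → ∣-*ʳ _ (p∣U j 1≤j))
    b , pdegV ← degreeMod-exists p V λ p∣V → p∤hm (⋆-∣ {I = m} λ j l _ 1≤l _ → ∣-*ˡ _ (p∣V l 1≤l))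
    Factorisation.absurd U V ncU ncV h≈UV valU valV degU degV pdegU pdegV
    where
    p∤hm : ¬ p ∣ (coeff U ⋆ coeff V) m
    p∤hm p∣UV = proj₁ (proj₂ h-degree-mod-p) (∣-respʳ (sym (h≈UV m 1≤m)) p∣UV)

cutoff : ℕ → (ℕ → X) → X → ℕ → X
cutoff N W x i with i ≤? N
... | yes _ = W i
... | no  _ = x

module FractionField {c₁ ℓ₁ c₂ ℓ₂} (R : CommutativeRing c₁ ℓ₁) (K : CommutativeRing c₂ ℓ₂)
                     (domain : IsIntegralDomain R)
                     (ι : CommutativeRing.Carrier R → CommutativeRing.Carrier K)
                     (quotientField : IsQuotientField R K ι) where
  private
    module R = CommutativeRing R
    module K = CommutativeRing K
    module RL = RingLemmas R
    module KL = RingLemmas K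
    module K* = CommutativeSemigroupProperties K.*-commutativeSemigroup
  open DomainLemmas R domain using (1≉0; *-≉0)
  open IsRingHomomorphism (proj₁ (proj₂ quotientField))
  open import Relation.Binary.Reasoning.Setoid K.setoid

  private
    K-field = proj₁ quotientField
    ι-injective = proj₁ (proj₂ (proj₂ quotientField))
    as-fraction = proj₂ (proj₂ (proj₂ quotientField))

  ι-≉0 : ∀ {b} → b R.≉ R.0# → ι b K.≉ K.0#
  ι-≉0 {b} b≉0 ιb≈0 = b≉0 (ι-injective b R.0# (K.trans ιb≈0 (K.sym 0#-homo)))

  K-cancel-≈0 : ∀ {a x} → a K.≉ K.0# → a K.* x K.≈ K.0# → x K.≈ K.0#
  K-cancel-≈0 {a} {x} a≉0 ax≈0 = begin
    x                    ≈⟨ K.*-identityˡ x ⟨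
    K.1# K.* x           ≈⟨ K.*-congʳ (K.trans (K.*-comm _ _) a⁻¹a≈1) ⟨
    a⁻¹ K.* a K.* x      ≈⟨ K.*-assoc a⁻¹ a x ⟩
    a⁻¹ K.* (a K.* x)    ≈⟨ K.*-congˡ ax≈0 ⟩
    a⁻¹ K.* K.0#         ≈⟨ K.zeroʳ a⁻¹ ⟩
    K.0#                 ∎
    where
    a⁻¹ = proj₁ (proj₂ K-field a a≉0)
    a⁻¹a≈1 = proj₂ (proj₂ K-field a a≉0)

  ι-sumTo : ∀ (h : ℕ → R.Carrier) N → ι (sumTo R h N) K.≈ sumTo K (λ j → ι (h j)) N
  ι-sumTo h zero    = 0#-homo
  ι-sumTo h (suc N) = K.trans (+-homo _ _) (K.+-congʳ (ι-sumTo h N))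

  ι-⋆-term : ∀ U V I j l → ι (RL.⋆-term U V I j l) K.≈ KL.⋆-term (λ j → ι (U j)) (λ l → ι (V l)) I j l
  ι-⋆-term U V I j l with j Nat.* l ≡ᵇ I
  ... | true  = *-homo (U j) (V l)
  ... | false = 0#-homo

  ι-⋆ : ∀ U V I → ι ((U RL.⋆ V) I) K.≈ ((λ j → ι (U j)) KL.⋆ (λ l → ι (V l))) I
  ι-⋆ U V I = K.trans (ι-sumTo _ I) (KL.sumTo-cong I λ j _ _ →
                K.trans (ι-sumTo _ I) (KL.sumTo-cong I λ l _ _ → ι-⋆-term U V I j l))

  ClearedUpTo : (ℕ → K.Carrier) → ℕ → Set _
  ClearedUpTo w N = ∃ λ B → B R.≉ R.0# × ∃ λ (W : ℕ → R.Carrier) →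
                    ∀ i → 1 ≤ i → i ≤ N → ι (W i) K.≈ ι B K.* w i

  clear-upTo : ∀ w N → ClearedUpTo w N
  clear-upTo w zero    = R.1# , 1≉0 , (λ _ → R.0#) , λ i 1≤i i≤0 → ⊥-elim (<⇒≱ 1≤i i≤0)
  clear-upTo w (suc N) with clear-upTo w N | as-fraction (w (suc N))
  ... | B , B≉0 , W , ιW≈ιBw | a , b , b≉0 , wb≈a =
    B R.* b , *-≉0 B≉0 b≉0 , cutoff N (λ i → W i R.* b) (a R.* B) , cleared
    where
    cleared : ∀ i → 1 ≤ i → i ≤ suc N → ι (cutoff N (λ i → W i R.* b) (a R.* B) i) K.≈ ι (B R.* b) K.* w i
    cleared i 1≤i i≤N+1 with i ≤? N
    ... | yes i≤N = begin
      ι (W i R.* b)            ≈⟨ *-homo (W i) b ⟩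
      ι (W i) K.* ι b          ≈⟨ K.*-congʳ (ιW≈ιBw i 1≤i i≤N) ⟩
      ι B K.* w i K.* ι b      ≈⟨ K*.xy∙z≈xz∙y _ _ _ ⟩
      ι B K.* ι b K.* w i      ≈⟨ K.*-congʳ (*-homo B b) ⟨
      ι (B R.* b) K.* w i      ∎
    ... | no  i≰N with ℕₚ.≤-antisym i≤N+1 (≰⇒> i≰N)
    ...   | ≡.refl = begin
      ι (a R.* B)              ≈⟨ *-homo a B ⟩
      ι a K.* ι B              ≈⟨ K.*-congʳ wb≈a ⟨
      w i K.* ι b K.* ι B      ≈⟨ K*.xy∙z≈zy∙x _ _ _ ⟩
      ι B K.* ι b K.* w i      ≈⟨ K.*-congʳ (*-homo B b) ⟨
      ι (B R.* b) K.* w i      ∎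

  clear-denominators : (u : DirPoly K) → ∃ λ B → B R.≉ R.0# × Σ (DirPoly R) λ U →
                       ∀ i → 1 ≤ i → ι (coeff U i) K.≈ ι B K.* coeff u i
  clear-denominators u with clear-upTo (coeff u) N
    where N = proj₁ (support u)
  ... | B , B≉0 , W , ιW≈ιBu = B , B≉0 , record { coeff = cutoff N W R.0# ; support = N , vanishes } , cleared
    where
    N = proj₁ (support u)
    vanishes : ∀ i → N < i → cutoff N W R.0# i R.≈ R.0#
    vanishes i N<i with i ≤? N
    ... | yes i≤N = ⊥-elim (<⇒≱ N<i i≤N)
    ... | no  _   = R.refl
    cleared : ∀ i → 1 ≤ i → ι (cutoff N W R.0# i) K.≈ ι B K.* coeff u i
    cleared i 1≤i with i ≤? N
    ... | yes i≤N = ιW≈ιBu i 1≤i i≤N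
    ... | no  i≰N = K.trans 0#-homo (K.sym (K.trans (K.*-congˡ (proj₂ (support u) i (≰⇒> i≰N))) (K.zeroʳ (ι B))))

  cleared-nonconstant : ∀ {B} (U : DirPoly R) (u : DirPoly K) → B R.≉ R.0# →
                        (∀ i → 1 ≤ i → ι (coeff U i) K.≈ ι B K.* coeff u i) → ¬ IsConstant K u → ¬ IsConstant R U
  cleared-nonconstant U u B≉0 ιU≈ιBu nonconstant constant = nonconstant λ i 2≤i →
    K-cancel-≈0 (ι-≉0 B≉0) (K.trans (K.sym (ιU≈ιBu i (≤-trans (s≤s z≤n) 2≤i)))
                                   (K.trans (⟦⟧-cong (constant i 2≤i)) 0#-homo))

  irreducible-over-fractions : ∀ h → (∀ c → c R.≉ R.0# → IrreducibleOver R R (λ x → x) (λ i → c R.* h i)) →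
                               IrreducibleOver R K ι h
  irreducible-over-fractions h irreducible (u , v , ncu , ncv , ιh≈uv)
    with clear-denominators u | clear-denominators v
  ... | B , B≉0 , U , ιU≈ιBu | C , C≉0 , V , ιV≈ιCv =
    irreducible (B R.* C) (*-≉0 B≉0 C≉0)
      (U , V , cleared-nonconstant U u B≉0 ιU≈ιBu ncu , cleared-nonconstant V v C≉0 ιV≈ιCv ncv , λ I 1≤I →
        ι-injective _ _ (begin
          ι (B R.* C R.* h I)                                          ≈⟨ *-homo (B R.* C) (h I) ⟩
          ι (B R.* C) K.* ι (h I)                                      ≈⟨ K.*-cong (*-homo B C) (ιh≈uv I 1≤I) ⟩
          ι B K.* ι C K.* (coeff u KL.⋆ coeff v) I                     ≈⟨ KL.⋆-scale _ _ (coeff u) (coeff v) I ⟨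
          ((λ j → ι B K.* coeff u j) KL.⋆ (λ l → ι C K.* coeff v l)) I
            ≈⟨ KL.⋆-cong (λ j 1≤j → K.sym (ιU≈ιBu j 1≤j)) (λ l 1≤l → K.sym (ιV≈ιCv l 1≤l)) I ⟩
          ((λ j → ι (coeff U j)) KL.⋆ (λ l → ι (coeff V l))) I          ≈⟨ ι-⋆ (coeff U) (coeff V) I ⟨
          ι ((coeff U RL.⋆ coeff V) I)                                 ∎))

open import Data.Nat using (_*_)
open import Data.Nat.Divisibility using (_∣_)
open import Data.Integer using (+_; _-_; ∣_∣)

theorem3p12 : {c₁ ℓ₁ c₂ ℓ₂ : Level}
    (R : CommutativeRing c₁ ℓ₁) → IsUFD R →
    (K : CommutativeRing c₂ ℓ₂) (ι : CommutativeRing.Carrier R → CommutativeRing.Carrier K) →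
    IsQuotientField R K ι →
    (f g : DirPoly R) (m n : ℕ) → HasDegree R f m → HasDegree R g n →
    Coprime m n → m < n →
    (p : CommutativeRing.Carrier R) → IsPrimeElt R p →
    ¬ Divides R p (coeff f m) → ¬ Divides R p (coeff g n) →
    (k : ℕ) → 1 ≤ k →
    (∀ d → d ∣ k → (∀ q → Prime q → q ∣ m * n → d ∣ ∣ + ν q n - + ν q m ∣) → d ≡ 1) →
    IrreducibleOver R K ι (addScaled R f (pow R p k) g)
theorem3p12 R ufd K ι quotientField f g m n deg-f deg-g coprime m<n p p-prime p∤fm p∤gn k 1≤k condition =
  irreducible-over-fractions h multiples-irreducible
  where
  module R = CommutativeRing R
  open RingLemmas R using (scale; *-addScaled; irreducible-cong)
  open DomainLemmas R (proj₁ ufd) using (scale-degree)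
  open PrimeLemmas R (proj₁ ufd) p p-prime using (exactly; ¬¬-valuation; irreducible-pow*; ∤⇒≉0; ∤-*)
  open FractionField R K (proj₁ ufd) ι quotientField using (irreducible-over-fractions)

  h : ℕ → R.Carrier
  h = addScaled R f (pow R p k) g

  scaled-irreducible : ∀ c₀ → ¬ Divides R p c₀ →
                       IrreducibleOver R R (λ x → x) (addScaled R (scale c₀ f) (pow R p k) (scale c₀ g))
  scaled-irreducible c₀ p∤c₀ = OverRing.irreducible R ufd p p-prime (scale c₀ f) (scale c₀ g)
    (scale-degree {f = f} (∤⇒≉0 p∤c₀) deg-f) (scale-degree {f = g} (∤⇒≉0 p∤c₀) deg-g) coprime m<n
    (∤-* p∤c₀ p∤fm) (∤-* p∤c₀ p∤gn) 1≤k condition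

  multiples-irreducible : ∀ c → c R.≉ R.0# → IrreducibleOver R R (λ x → x) (λ i → c R.* h i)
  multiples-irreducible c c≉0 factorisation = do
    s , exactly c₀ c≈pˢc₀ p∤c₀ ← ¬¬-valuation ufd c≉0
    irreducible-cong (λ i → R.sym (*-addScaled c≈pˢc₀ f (pow R p k) g i))
                     (irreducible-pow* s _ (scaled-irreducible c₀ p∤c₀)) factorisation
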